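{- Let $e=(\mathbf{e}_1,\dots,\mathbf{e}_u)$ and $f=(\mathbf{f}_1,\dots,\mathbf{f}_v)$ be disjoint tuples of vectors in $\mathbb{N}^d$ such that $|e|=|f|$, $\Delta_{e,f}(\mathbf{x})\ge1$ for all $\mathbf{x}\in\mathcal{D}_{e,f}$, and $e$ is $1$-admissible. Then $\mathfrak{S}_{e,f}$ is integer-valued and satisfies the $p$-Lucas property for every prime $p$.
   Context: "Disjoint" means no vector occurs both as a component of $e$ and of $f$. $|e|=\sum_i\mathbf{e}_i$; for $\mathbf{n}\in\mathbb{N}^d$, $|\mathbf{n}|$ is the sum of its coordinates. $\mathcal{Q}_{e,f}(\mathbf{n})=\prod_{i=1}^u(\mathbf{e}_i\cdot\mathbf{n})!/\prod_{i=1}^v(\mathbf{f}_i\cdot\mathbf{n})!$ and $\mathfrak{S}_{e,f}(m)=\sum_{\mathbf{n}\in\mathbb{N}^d,|\mathbf{n}|=m}\mathcal{Q}_{e,f}(\mathbf{n})$. $\Delta_{e,f}(\mathbf{x})=\sum_i\lfloor\mathbf{e}_i\cdot\mathbf{x}\rfloor-\sum_i\lfloor\mathbf{f}_i\cdot\mathbf{x}\rfloor$. $\mathcal{D}_{e,f}$ is the set of $\mathbf{x}\in[0,1)^d$ with $\mathbf{d}\cdot\mathbf{x}\ge1$ for some component $\mathbf{d}$ of $e$ or $f$. $e$ is $1$-admissible if either some $\mathbf{e}_i$ satisfies $\mathbf{e}_i\ge(1,\dots,1)$ coordinatewise, or for every $k\in\{1,\dots,d\}$ some $\mathbf{e}_i$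 has $k$-th coordinate $\ge d$. A sequence $A$ satisfies the $p$-Lucas property if $A(v+np)\equiv A(v)A(n)\pmod p$ for all $v\in\{0,\dots,p-1\}$, $n\in\mathbb{N}$. -}

module Defs where

open import Data.Nat as ℕ using (ℕ; zero; suc; _∸_; _!; _≥_)
open import Data.Nat.Properties using (_!≢0)
open import Data.Fin using (Fin)
open import Data.Vec using (Vec; []; _∷_; lookup; zipWith; replicate; foldr)
open import Data.List as L using (List)
open import Data.Integer as ℤ using (ℤ; +_)
open import Data.Integer.Divisibility as ℤD using ()
open import Data.Rational as ℚ using (ℚ; 0ℚ; 1ℚ; floor)
open import Data.Product using (Σ; ∃; _×_; _,_)
open import Data.Sum using (_⊎_)
open import Relation.Binary.PropositionalEquality using (_≡_; _≢_)
open import Relation.Nullary using (¬_)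

Vecℕ : ℕ → Set
Vecℕ d = Vec ℕ d

Tuple : ℕ → ℕ → Set
Tuple d k = Vec (Vec ℕ d) k

dotℕ : ∀ {d} → Vec ℕ d → Vec ℕ d → ℕ
dotℕ a b = foldr (λ _ → ℕ) ℕ._+_ 0 (zipWith ℕ._*_ a b)

dotℚ : ∀ {d} → Vec ℕ d → Vec ℚ d → ℚ
dotℚ a x = foldr (λ _ → ℚ) ℚ._+_ 0ℚ (zipWith (λ k y → (+ k ℚ./ 1) ℚ.* y) a x)

∣_∣ᵥ : ∀ {d} → Vec ℕ d → ℕ
∣ n ∣ᵥ = foldr (λ _ → ℕ) ℕ._+_ 0 n

tupleSum : ∀ {d k} → Tuple d k → Vec ℕ d
tupleSum {d} e = foldr (λ _ → Vec ℕ d) (zipWith ℕ._+_) (replicate d 0) e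

Disjoint : ∀ {d u v} → Tuple d u → Tuple d v → Set
Disjoint {u = u} {v} e f = (i : Fin u) (j : Fin v) → lookup e i ≢ lookup f j

compositions : (d m : ℕ) → List (Vec ℕ d)
compositions zero zero = L.[ [] ]
compositions zero (suc m) = L.[]
compositions (suc d) m =
  L.concatMap (λ k → L.map (k ∷_) (compositions d (m ∸ k))) (L.upTo (suc m))

invFact : ℕ → ℚ
invFact k = (+ 1 ℚ./ (k !)) {{k !≢0}}

Q : ∀ {d u v} → Tuple d u → Tuple d v → Vec ℕ d → ℚ
Q e f n =
  foldr (λ _ → ℚ) (λ a r → (+ (dotℕ a n !) ℚ./ 1) ℚ.* r) 1ℚ e
  ℚ.* foldr (λ _ → ℚ) (λ b r → invFact (dotℕ b n) ℚ.* r) 1ℚ f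

𝔖 : ∀ {d u v} → Tuple d u → Tuple d v → ℕ → ℚ
𝔖 {d} e f m = L.foldr ℚ._+_ 0ℚ (L.map (Q e f) (compositions d m))

Δ : ∀ {d u v} → Tuple d u → Tuple d v → Vec ℚ d → ℤ
Δ e f x =
  foldr (λ _ → ℤ) (λ a r → floor (dotℚ a x) ℤ.+ r) (+ 0) e
  ℤ.- foldr (λ _ → ℤ) (λ b r → floor (dotℚ b x) ℤ.+ r) (+ 0) f

InUnitCube : ∀ {d} → Vec ℚ d → Set
InUnitCube {d} x = (k : Fin d) → (0ℚ ℚ.≤ lookup x k) × (lookup x k ℚ.< 1ℚ)

InD : ∀ {d u v} → Tuple d u → Tuple d v → Vec ℚ d → Set
InD {u = u} {v} e f x =
  InUnitCube x ×
  ((Σ (Fin u) λ i → 1ℚ ℚ.≤ dotℚ (lookup e i) x) ⊎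
   (Σ (Fin v) λ j → 1ℚ ℚ.≤ dotℚ (lookup f j) x))

OneAdmissible : ∀ {d u} → Tuple d u → Set
OneAdmissible {d} {u} e =
  (Σ (Fin u) λ i → (k : Fin d) → lookup (lookup e i) k ≥ 1) ⊎
  ((k : Fin d) → Σ (Fin u) λ i → lookup (lookup e i) k ≥ d)

LucasProperty : ℕ → (ℕ → ℤ) → Set
LucasProperty p A =
  (w n : ℕ) → w ℕ.< p → (+ p) ℤD.∣ (A (w ℕ.+ n ℕ.* p) ℤ.- A w ℤ.* A n)

module Submission where

-- Write E(n) = ∏ (eᵢ·n)! and F(n) = ∏ (fⱼ·n)!, so that Q_{e,f}(n) = E(n)/F(n).
-- Integrality: by Landau's criterion F(n) ∣ E(n) once Σ ⌊fⱼ·n/P⌋ ≤ Σ ⌊eᵢ·n/P⌋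
-- for every P ≥ 1.  Writing n = c + Pb with c ∈ [0,P)^d, the balance |e| = |f|
-- cancels the contribution of b, and at the grid point c/P the difference of
-- the floor sums is Δ_{e,f}(c/P), which is ≥ 1 on D_{e,f} and 0 off it.  Hence
-- Q(n) = q(n) ∈ ℕ and 𝔖(m) = S(m) = Σ_{|n|=m} q(n).
-- Lucas property: for p prime and n = a + pb with a ∈ [0,p)^d, the base-p
-- factorisation (r + sp)! = p^s · s! · U with U ≡ ((p-1)!)^s · r! (mod p) gives
-- q(a + pb) ≡ q(a) q(b) when all values eᵢ·a, fⱼ·a are < p; otherwise Δ(a/p) ≥ 1
-- and Landau's criterion yields an extra factor p, so p ∣ q(a + pb).  Summing
-- over a box, the level |a + pb| = w + Np splits as |a| = w and |b| = N, except
-- when |a| ≥ p, where 1-admissibility puts a/p into D_{e,f}.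
-- The modules below develop: congruences mod p, finite sums, factorials mod p,
-- prime powers and Landau's criterion, linear forms and floor sums, rationals
-- and grid points, integrality, the Lucas congruence, and finally the theorem.

module Congruence where

  open import Data.Nat as ℕ using (ℕ)
  import Data.Nat.Divisibility as ℕ
  open import Data.Nat.Primality using (Prime; euclidsLemma)
  open import Data.Integer as ℤ using (ℤ; +_)
  import Data.Integer.Properties as ℤ
  import Data.Integer.Divisibility.Signed as ℤ
  open import Data.Integer.Tactic.RingSolver using (solve-∀)
  open import Data.Sum using (inj₁; inj₂)
  open import Data.Empty using (⊥-elim)
  open import Relation.Nullary using (¬_)
  open import Relation.Binary.PropositionalEquality
  open import Relation.Binary.Bundles using (Setoid)
  import Relation.Binary.Reasoning.Setoid as SetoidReasoning

  -- Congruence of natural numbers modulo p, phrased through integer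
  -- divisibility of the difference (the form in which the Lucas property is
  -- stated).
  module Mod (p : ℕ) where

    infix 4 _≈_
    record _≈_ (x y : ℕ) : Set where
      constructor mk≈
      field divides-difference : (+ p) ℤ.∣ (+ x ℤ.- + y)
    open _≈_ public

    private
      p∣_ : ℤ → Set
      p∣ z = (+ p) ℤ.∣ z

      neg-difference : ∀ (a b : ℤ) → ℤ.- (a ℤ.- b) ≡ b ℤ.- a
      neg-difference = solve-∀
      telescope : ∀ (a b c : ℤ) → (a ℤ.- b) ℤ.+ (b ℤ.- c) ≡ a ℤ.- c
      telescope = solve-∀
      sum-difference : ∀ (a b c d : ℤ) → (a ℤ.+ b) ℤ.- (c ℤ.+ d) ≡ (a ℤ.- c) ℤ.+ (b ℤ.- d)
      sum-difference = solve-∀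
      product-difference : ∀ (a b c d : ℤ) → (a ℤ.* b) ℤ.- (c ℤ.* d) ≡ a ℤ.* (b ℤ.- d) ℤ.+ (a ℤ.- c) ℤ.* d
      product-difference = solve-∀
      scaled-difference : ∀ (c a b : ℤ) → (c ℤ.* a) ℤ.- (c ℤ.* b) ≡ c ℤ.* (a ℤ.- b)
      scaled-difference = solve-∀

    ≈-refl : ∀ {x} → x ≈ x
    ≈-refl {x} = mk≈ (ℤ.divides (+ 0) (trans (ℤ.+-inverseʳ (+ x)) (sym (ℤ.*-zeroˡ (+ p)))))

    ≈-reflexive : ∀ {x y} → x ≡ y → x ≈ y
    ≈-reflexive refl = ≈-refl

    ≈-sym : ∀ {x y} → x ≈ y → y ≈ x
    ≈-sym {x} {y} (mk≈ h) = mk≈ (subst p∣_ (neg-difference (+ x) (+ y)) (ℤ.∣m⇒∣-m h))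

    ≈-trans : ∀ {x y z} → x ≈ y → y ≈ z → x ≈ z
    ≈-trans {x} {y} {z} (mk≈ h) (mk≈ h′) =
      mk≈ (subst p∣_ (telescope (+ x) (+ y) (+ z)) (ℤ.∣m∣n⇒∣m+n h h′))

    ≈-setoid : Setoid _ _
    ≈-setoid = record
      { Carrier = ℕ ; _≈_ = _≈_
      ; isEquivalence = record { refl = ≈-refl ; sym = ≈-sym ; trans = ≈-trans } }

    module ≈-Reasoning = SetoidReasoning ≈-setoid

    +-cong≈ : ∀ {x y x′ y′} → x ≈ y → x′ ≈ y′ → x ℕ.+ x′ ≈ y ℕ.+ y′
    +-cong≈ {x} {y} {x′} {y′} (mk≈ h) (mk≈ h′) = mk≈ (subst p∣_ eq (ℤ.∣m∣n⇒∣m+n h h′))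
      where
      eq : (+ x ℤ.- + y) ℤ.+ (+ x′ ℤ.- + y′) ≡ + (x ℕ.+ x′) ℤ.- + (y ℕ.+ y′)
      eq = trans (sym (sum-difference (+ x) (+ x′) (+ y) (+ y′)))
                 (sym (cong₂ ℤ._-_ (ℤ.pos-+ x x′) (ℤ.pos-+ y y′)))

    *-cong≈ : ∀ {x y x′ y′} → x ≈ y → x′ ≈ y′ → x ℕ.* x′ ≈ y ℕ.* y′
    *-cong≈ {x} {y} {x′} {y′} (mk≈ h) (mk≈ h′) =
      mk≈ (subst p∣_ eq (ℤ.∣m∣n⇒∣m+n (ℤ.∣n⇒∣m*n (+ x) h′) (ℤ.∣m⇒∣m*n (+ y′) h)))
      where
      eq : + x ℤ.* (+ x′ ℤ.- + y′) ℤ.+ (+ x ℤ.- + y) ℤ.* + y′ ≡ + (x ℕ.* x′) ℤ.- + (y ℕ.* y′)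
      eq = trans (sym (product-difference (+ x) (+ x′) (+ y) (+ y′)))
                 (sym (cong₂ ℤ._-_ (ℤ.pos-* x x′) (ℤ.pos-* y y′)))

    ∣⇒≈0 : ∀ {x} → p ℕ.∣ x → x ≈ 0
    ∣⇒≈0 {x} (ℕ.divides q eq) =
      mk≈ (ℤ.divides (+ q) (trans (ℤ.+-identityʳ (+ x)) (trans (cong +_ eq) (ℤ.pos-* q p))))

    ≈0⇒∣ : ∀ {x} → x ≈ 0 → p ℕ.∣ x
    ≈0⇒∣ {x} (mk≈ h) = subst (λ t → p ℕ.∣ ℤ.∣ t ∣) (ℤ.+-identityʳ (+ x)) (ℤ.∣⇒∣ᵤ h)

    cancel≈ : Prime p → ∀ {c x y} → ¬ (p ℕ.∣ c) → c ℕ.* x ≈ c ℕ.* y → x ≈ y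
    cancel≈ pr {c} {x} {y} p∤c (mk≈ h) with euclidsLemma c ℤ.∣ + x ℤ.- + y ∣ pr p∣c*∣x-y∣
      where
      p∣c*[x-y] : p∣ (+ c ℤ.* (+ x ℤ.- + y))
      p∣c*[x-y] = subst p∣_ (trans (cong₂ ℤ._-_ (ℤ.pos-* c x) (ℤ.pos-* c y))
                                   (scaled-difference (+ c) (+ x) (+ y))) h
      p∣c*∣x-y∣ : p ℕ.∣ c ℕ.* ℤ.∣ + x ℤ.- + y ∣
      p∣c*∣x-y∣ = subst (p ℕ.∣_) (ℤ.abs-* (+ c) (+ x ℤ.- + y)) (ℤ.∣⇒∣ᵤ p∣c*[x-y])
    ... | inj₁ p∣c = ⊥-elim (p∤c p∣c)
    ... | inj₂ p∣∣x-y∣ = mk≈ (ℤ.∣ᵤ⇒∣ p∣∣x-y∣)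

module FiniteSums where

  open import Data.Nat as ℕ using (ℕ; zero; suc; _+_; _*_; _∸_; _≤_; _<_; z≤n; s≤s)
  import Data.Nat.Properties as ℕ
  open import Data.Nat.Tactic.RingSolver using (solve-∀)
  open import Data.Vec as Vec using (Vec; []; _∷_)
  open import Data.Vec.Relation.Unary.All using (All; []; _∷_)
  open import Data.List as List using (List)
  open import Data.Empty using (⊥-elim)
  open import Relation.Nullary using (Dec; yes; no; ¬_)
  open import Relation.Binary.PropositionalEquality
  open import Data.Nat.DivMod using (_/_; _%_; m≡m%n+[m/n]*n; m%n<n)
  open import Defs using (∣_∣ᵥ; compositions)
  open Congruence

  sumUpTo : ℕ → (ℕ → ℕ) → ℕ
  sumUpTo zero    h = 0
  sumUpTo (suc n) h = h 0 + sumUpTo n (λ k → h (suc k))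

  boxSum : (d B : ℕ) → (Vec ℕ d → ℕ) → ℕ
  boxSum zero    B g = g []
  boxSum (suc d) B g = sumUpTo B (λ k → boxSum d B (λ v → g (k ∷ v)))

  listSum : ∀ {A : Set} → List A → (A → ℕ) → ℕ
  listSum xs g = List.foldr (λ x r → g x + r) 0 xs

  -- a + P·b, coordinatewise: the vector with base-P "low digits" a and
  -- "high part" b
  infixl 6 _⊕[_]_
  _⊕[_]_ : ∀ {d} → Vec ℕ d → ℕ → Vec ℕ d → Vec ℕ d
  a ⊕[ P ] b = Vec.zipWith (λ x y → x + y * P) a b

  ⊕-digits : ∀ {d} P .{{_ : ℕ.NonZero P}} (v : Vec ℕ d) → Vec.map (_% P) v ⊕[ P ] Vec.map (_/ P) v ≡ v
  ⊕-digits P []       = refl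
  ⊕-digits P (x ∷ v) = cong₂ _∷_ (sym (m≡m%n+[m/n]*n x P)) (⊕-digits P v)

  %-bounded : ∀ {d} P .{{_ : ℕ.NonZero P}} (v : Vec ℕ d) → All (_< P) (Vec.map (_% P) v)
  %-bounded P []      = []
  %-bounded P (x ∷ v) = m%n<n x P ∷ %-bounded P v

  sumUpTo-cong : ∀ n {h h′} → (∀ k → k < n → h k ≡ h′ k) → sumUpTo n h ≡ sumUpTo n h′
  sumUpTo-cong zero    eq = refl
  sumUpTo-cong (suc n) eq =
    cong₂ _+_ (eq 0 (s≤s z≤n)) (sumUpTo-cong n (λ k k<n → eq (suc k) (s≤s k<n)))

  sumUpTo-congᵘ : ∀ n {h h′} → (∀ k → h k ≡ h′ k) → sumUpTo n h ≡ sumUpTo n h′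
  sumUpTo-congᵘ n eq = sumUpTo-cong n (λ k _ → eq k)

  sumUpTo-zero : ∀ n {h} → (∀ k → h k ≡ 0) → sumUpTo n h ≡ 0
  sumUpTo-zero zero    eq = refl
  sumUpTo-zero (suc n) eq = cong₂ _+_ (eq 0) (sumUpTo-zero n (λ k → eq (suc k)))

  sumUpTo-+ : ∀ n (h h′ : ℕ → ℕ) → sumUpTo n (λ k → h k + h′ k) ≡ sumUpTo n h + sumUpTo n h′
  sumUpTo-+ zero    h h′ = refl
  sumUpTo-+ (suc n) h h′ =
    trans (cong (λ t → h 0 + h′ 0 + t) (sumUpTo-+ n _ _)) (interchange (h 0) (h′ 0) _ _)
    where
    interchange : ∀ a b c d → a + b + (c + d) ≡ a + c + (b + d)
    interchange = solve-∀

  sumUpTo-*ˡ : ∀ n c (h : ℕ → ℕ) → sumUpTo n (λ k → c * h k) ≡ c * sumUpTo n h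
  sumUpTo-*ˡ zero    c h = sym (ℕ.*-zeroʳ c)
  sumUpTo-*ˡ (suc n) c h =
    trans (cong (c * h 0 +_) (sumUpTo-*ˡ n c _)) (sym (ℕ.*-distribˡ-+ c (h 0) _))

  sumUpTo-*ʳ : ∀ n c (h : ℕ → ℕ) → sumUpTo n (λ k → h k * c) ≡ sumUpTo n h * c
  sumUpTo-*ʳ zero    c h = refl
  sumUpTo-*ʳ (suc n) c h =
    trans (cong (h 0 * c +_) (sumUpTo-*ʳ n c _)) (sym (ℕ.*-distribʳ-+ c (h 0) _))

  sumUpTo-swap : ∀ n m (h : ℕ → ℕ → ℕ) →
    sumUpTo n (λ i → sumUpTo m (h i)) ≡ sumUpTo m (λ j → sumUpTo n (λ i → h i j))
  sumUpTo-swap zero    m h = sym (sumUpTo-zero m (λ _ → refl))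
  sumUpTo-swap (suc n) m h =
    trans (cong (sumUpTo m (h 0) +_) (sumUpTo-swap n m (λ i → h (suc i))))
          (sym (sumUpTo-+ m (h 0) (λ j → sumUpTo n (λ i → h (suc i) j))))

  sumUpTo-split : ∀ m n (h : ℕ → ℕ) → sumUpTo (m + n) h ≡ sumUpTo m h + sumUpTo n (λ k → h (m + k))
  sumUpTo-split zero    n h = refl
  sumUpTo-split (suc m) n h =
    trans (cong (h 0 +_) (sumUpTo-split m n (λ k → h (suc k)))) (sym (ℕ.+-assoc (h 0) _ _))

  sumUpTo-extend : ∀ {m M} (h : ℕ → ℕ) → m ≤ M → (∀ j → h (suc m + j) ≡ 0) →
    sumUpTo (suc m) h ≡ sumUpTo (suc M) h
  sumUpTo-extend {m} {M} h m≤M vanish = begin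
    sumUpTo (suc m) h                                        ≡⟨ sym (ℕ.+-identityʳ _) ⟩
    sumUpTo (suc m) h + 0                                    ≡⟨ cong (sumUpTo (suc m) h +_) (sym (sumUpTo-zero (M ∸ m) vanish)) ⟩
    sumUpTo (suc m) h + sumUpTo (M ∸ m) (λ j → h (suc m + j)) ≡⟨ sym (sumUpTo-split (suc m) (M ∸ m) h) ⟩
    sumUpTo (suc m + (M ∸ m)) h                              ≡⟨ cong (λ t → sumUpTo (suc t) h) (ℕ.m+[n∸m]≡n m≤M) ⟩
    sumUpTo (suc M) h                                        ∎
    where open ≡-Reasoning

  sumUpTo-blocks : ∀ N P (h : ℕ → ℕ) →
    sumUpTo (suc N * P) h ≡ sumUpTo (suc N) (λ b → sumUpTo P (λ a → h (a + b * P)))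
  sumUpTo-blocks zero P h = begin
    sumUpTo (P + 0) h                  ≡⟨ cong (λ t → sumUpTo t h) (ℕ.+-identityʳ P) ⟩
    sumUpTo P h                        ≡⟨ sumUpTo-congᵘ P (λ a → cong h (sym (ℕ.+-identityʳ a))) ⟩
    sumUpTo P (λ a → h (a + 0))        ≡⟨ sym (ℕ.+-identityʳ _) ⟩
    sumUpTo P (λ a → h (a + 0)) + 0    ∎
    where open ≡-Reasoning
  sumUpTo-blocks (suc N) P h = begin
    sumUpTo (P + suc N * P) h
      ≡⟨ sumUpTo-split P (suc N * P) h ⟩
    sumUpTo P h + sumUpTo (suc N * P) (λ k → h (P + k))
      ≡⟨ cong₂ _+_ (sumUpTo-congᵘ P (λ a → cong h (sym (ℕ.+-identityʳ a))))
                   (sumUpTo-blocks N P (λ k → h (P + k))) ⟩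
    sumUpTo P (λ a → h (a + 0)) + sumUpTo (suc N) (λ b → sumUpTo P (λ a → h (P + (a + b * P))))
      ≡⟨ cong (sumUpTo P (λ a → h (a + 0)) +_)
           (sumUpTo-congᵘ (suc N) (λ b → sumUpTo-congᵘ P (λ a → cong h (shift P a b)))) ⟩
    sumUpTo P (λ a → h (a + 0 * P)) + sumUpTo (suc N) (λ b → sumUpTo P (λ a → h (a + suc b * P)))
      ∎
    where
    open ≡-Reasoning
    shift : ∀ P a b → P + (a + b * P) ≡ a + (P + b * P)
    shift = solve-∀

  boxSum-cong : ∀ d B {g g′} → (∀ v → g v ≡ g′ v) → boxSum d B g ≡ boxSum d B g′
  boxSum-cong zero    B eq = eq []
  boxSum-cong (suc d) B eq = sumUpTo-congᵘ B (λ k → boxSum-cong d B (λ v → eq (k ∷ v)))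

  boxSum-zero : ∀ d B {g} → (∀ v → g v ≡ 0) → boxSum d B g ≡ 0
  boxSum-zero zero    B eq = eq []
  boxSum-zero (suc d) B eq = sumUpTo-zero B (λ k → boxSum-zero d B (λ v → eq (k ∷ v)))

  boxSum-*ˡ : ∀ d B c g → boxSum d B (λ v → c * g v) ≡ c * boxSum d B g
  boxSum-*ˡ zero    B c g = refl
  boxSum-*ˡ (suc d) B c g = trans (sumUpTo-congᵘ B (λ k → boxSum-*ˡ d B c _)) (sumUpTo-*ˡ B c _)

  boxSum-*ʳ : ∀ d B c g → boxSum d B (λ v → g v * c) ≡ boxSum d B g * c
  boxSum-*ʳ zero    B c g = refl
  boxSum-*ʳ (suc d) B c g = trans (sumUpTo-congᵘ B (λ k → boxSum-*ʳ d B c _)) (sumUpTo-*ʳ B c _)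

  sumUpTo-boxSum : ∀ n d B (h : ℕ → Vec ℕ d → ℕ) →
    sumUpTo n (λ i → boxSum d B (h i)) ≡ boxSum d B (λ v → sumUpTo n (λ i → h i v))
  sumUpTo-boxSum n zero    B h = refl
  sumUpTo-boxSum n (suc d) B h =
    trans (sumUpTo-swap n B _) (sumUpTo-congᵘ B (λ k → sumUpTo-boxSum n d B (λ i v → h i (k ∷ v))))

  boxSum-separate : ∀ d B C (g h : Vec ℕ d → ℕ) →
    boxSum d B (λ a → boxSum d C (λ b → g a * h b)) ≡ boxSum d B g * boxSum d C h
  boxSum-separate d B C g h =
    trans (boxSum-cong d B (λ a → boxSum-*ˡ d C (g a) h)) (boxSum-*ʳ d B (boxSum d C h) g)

  boxSum-blocks : ∀ d N P (G : Vec ℕ d → ℕ) →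
    boxSum d (suc N * P) G ≡ boxSum d P (λ a → boxSum d (suc N) (λ b → G (a ⊕[ P ] b)))
  boxSum-blocks zero    N P G = refl
  boxSum-blocks (suc d) N P G = begin
    sumUpTo (suc N * P) (λ k → boxSum d (suc N * P) (λ v → G (k ∷ v)))
      ≡⟨ sumUpTo-congᵘ (suc N * P) (λ k → boxSum-blocks d N P (λ v → G (k ∷ v))) ⟩
    sumUpTo (suc N * P) H
      ≡⟨ sumUpTo-blocks N P H ⟩
    sumUpTo (suc N) (λ b₀ → sumUpTo P (λ a₀ → H (a₀ + b₀ * P)))
      ≡⟨ sumUpTo-swap (suc N) P (λ b₀ a₀ → H (a₀ + b₀ * P)) ⟩
    sumUpTo P (λ a₀ → sumUpTo (suc N) (λ b₀ → H (a₀ + b₀ * P)))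
      ≡⟨ sumUpTo-congᵘ P (λ a₀ → sumUpTo-boxSum (suc N) d P
           (λ b₀ a → boxSum d (suc N) (λ b → G ((a₀ + b₀ * P) ∷ (a ⊕[ P ] b))))) ⟩
    sumUpTo P (λ a₀ → boxSum d P (λ a → sumUpTo (suc N) (λ b₀ →
      boxSum d (suc N) (λ b → G ((a₀ + b₀ * P) ∷ (a ⊕[ P ] b))))))
      ∎
    where
    open ≡-Reasoning
    H : ℕ → ℕ
    H k = boxSum d P (λ a → boxSum d (suc N) (λ b → G (k ∷ (a ⊕[ P ] b))))

  module _ (p : ℕ) where
    open Mod p

    sumUpTo-cong≈ : ∀ n {h h′} → (∀ k → k < n → h k ≈ h′ k) → sumUpTo n h ≈ sumUpTo n h′
    sumUpTo-cong≈ zero    eq = ≈-refl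
    sumUpTo-cong≈ (suc n) eq =
      +-cong≈ (eq 0 (s≤s z≤n)) (sumUpTo-cong≈ n (λ k k<n → eq (suc k) (s≤s k<n)))

    boxSum-cong≈ : ∀ d B {g g′} → (∀ v → All (_< B) v → g v ≈ g′ v) → boxSum d B g ≈ boxSum d B g′
    boxSum-cong≈ zero    B eq = eq [] []
    boxSum-cong≈ (suc d) B eq =
      sumUpTo-cong≈ B (λ k k<B → boxSum-cong≈ d B (λ v hv → eq (k ∷ v) (k<B ∷ hv)))

  listSum-++ : ∀ {A : Set} (xs ys : List A) g → listSum (xs List.++ ys) g ≡ listSum xs g + listSum ys g
  listSum-++ List.[]       ys g = refl
  listSum-++ (x List.∷ xs) ys g =
    trans (cong (g x +_) (listSum-++ xs ys g)) (sym (ℕ.+-assoc (g x) _ _))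

  listSum-map : ∀ {A B : Set} (h : A → B) (xs : List A) g →
    listSum (List.map h xs) g ≡ listSum xs (λ x → g (h x))
  listSum-map h List.[]       g = refl
  listSum-map h (x List.∷ xs) g = cong (g (h x) +_) (listSum-map h xs g)

  listSum-concatMap : ∀ {A B : Set} (h : A → List B) (xs : List A) g →
    listSum (List.concatMap h xs) g ≡ listSum xs (λ x → listSum (h x) g)
  listSum-concatMap h List.[]       g = refl
  listSum-concatMap h (x List.∷ xs) g =
    trans (listSum-++ (h x) _ g) (cong (listSum (h x) g +_) (listSum-concatMap h xs g))

  listSum-upTo : ∀ n g → listSum (List.upTo n) g ≡ sumUpTo n g
  listSum-upTo n g = go (λ k → k) n
    where
    go : ∀ (f : ℕ → ℕ) n → listSum (List.applyUpTo f n) g ≡ sumUpTo n (λ k → g (f k))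
    go f zero    = refl
    go f (suc n) = cong (g (f 0) +_) (go (λ k → f (suc k)) n)

  guard : ∀ {P : Set} → Dec P → ℕ → ℕ
  guard (yes _) x = x
  guard (no _)  x = 0

  guard-⇔ : ∀ {P Q : Set} (dP : Dec P) (dQ : Dec Q) → (P → Q) → (Q → P) → ∀ x → guard dP x ≡ guard dQ x
  guard-⇔ (yes _)  (yes _)  _ _ x = refl
  guard-⇔ (yes p)  (no ¬q)  f _ x = ⊥-elim (¬q (f p))
  guard-⇔ (no ¬p)  (yes q)  _ g x = ⊥-elim (¬p (g q))
  guard-⇔ (no _)   (no _)   _ _ x = refl

  guard-no : ∀ {P : Set} (dP : Dec P) → ¬ P → ∀ x → guard dP x ≡ 0
  guard-no (yes p) ¬p x = ⊥-elim (¬p p)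
  guard-no (no _)  _  x = refl

  atLevel : ∀ {d} → ℕ → Vec ℕ d → ℕ → ℕ
  atLevel m v x = guard (∣ v ∣ᵥ ℕ.≟ m) x

  compositions-boxSum : ∀ d m M (g : Vec ℕ d → ℕ) → m ≤ M →
    listSum (compositions d m) g ≡ boxSum d (suc M) (λ v → atLevel m v (g v))
  compositions-boxSum zero    zero    M g m≤M = ℕ.+-identityʳ (g [])
  compositions-boxSum zero    (suc m) M g m≤M = refl
  compositions-boxSum (suc d) m       M g m≤M = begin
    listSum (List.concatMap (λ k → List.map (k ∷_) (compositions d (m ∸ k))) (List.upTo (suc m))) g
      ≡⟨ listSum-concatMap (λ k → List.map (k ∷_) (compositions d (m ∸ k))) (List.upTo (suc m)) g ⟩
    listSum (List.upTo (suc m)) (λ k → listSum (List.map (k ∷_) (compositions d (m ∸ k))) g)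
      ≡⟨ listSum-upTo (suc m) _ ⟩
    sumUpTo (suc m) (λ k → listSum (List.map (k ∷_) (compositions d (m ∸ k))) g)
      ≡⟨ sumUpTo-cong (suc m) (λ k k≤m → trans (listSum-map (k ∷_) (compositions d (m ∸ k)) g)
           (compositions-boxSum d (m ∸ k) M (λ v → g (k ∷ v)) (ℕ.≤-trans (ℕ.m∸n≤m m k) m≤M))) ⟩
    sumUpTo (suc m) (λ k → boxSum d (suc M) (λ v → atLevel (m ∸ k) v (g (k ∷ v))))
      ≡⟨ sumUpTo-cong (suc m) (λ k k≤m → boxSum-cong d (suc M) (λ v →
           guard-⇔ (∣ v ∣ᵥ ℕ.≟ m ∸ k) (k + ∣ v ∣ᵥ ℕ.≟ m)
                   (to k v (ℕ.≤-pred k≤m)) (from k v (ℕ.≤-pred k≤m)) (g (k ∷ v)))) ⟩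
    sumUpTo (suc m) G
      ≡⟨ sumUpTo-extend G m≤M (λ j → boxSum-zero d (suc M) (λ v →
           guard-no (suc m + j + ∣ v ∣ᵥ ℕ.≟ m) (too-large j v) (g ((suc m + j) ∷ v)))) ⟩
    sumUpTo (suc M) G
      ∎
    where
    open ≡-Reasoning
    G : ℕ → ℕ
    G k = boxSum d (suc M) (λ v → atLevel m (k ∷ v) (g (k ∷ v)))
    to : ∀ k (v : Vec ℕ d) → k ≤ m → ∣ v ∣ᵥ ≡ m ∸ k → k + ∣ v ∣ᵥ ≡ m
    to k v k≤m eq = trans (cong (k +_) eq) (ℕ.m+[n∸m]≡n k≤m)
    from : ∀ k (v : Vec ℕ d) → k ≤ m → k + ∣ v ∣ᵥ ≡ m → ∣ v ∣ᵥ ≡ m ∸ k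
    from k v k≤m eq = trans (sym (ℕ.m+n∸m≡n k ∣ v ∣ᵥ)) (cong (_∸ k) eq)
    too-large : ∀ j (v : Vec ℕ d) → ¬ (suc m + j + ∣ v ∣ᵥ ≡ m)
    too-large j v eq = ℕ.<-irrefl (sym eq)
      (ℕ.≤-trans (s≤s (ℕ.m≤m+n m j)) (ℕ.m≤m+n (suc m + j) ∣ v ∣ᵥ))

module Factorials where

  open import Data.Nat as ℕ using (ℕ; zero; suc; _+_; _*_; _<_; _^_; _!)
  import Data.Nat.Properties as ℕ
  open import Data.Nat.Divisibility using (_∣_; ∣1⇒≡1; ∣⇒≤)
  open import Data.Nat.Tactic.RingSolver using (solve-∀)
  open import Data.Nat.Primality using (Prime; ¬prime[1]; euclidsLemma)
  open import Data.Vec as Vec using (Vec; []; _∷_)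
  open import Data.Vec.Relation.Unary.All using (All; []; _∷_)
  open import Data.Integer as ℤ using (+_)
  import Data.Integer.Properties as ℤ
  import Data.Integer.Divisibility.Signed as ℤ
  import Data.Integer.Tactic.RingSolver as ℤ
  open import Data.Product using (Σ; _×_; _,_)
  open import Data.Sum using (inj₁; inj₂)
  open import Relation.Nullary using (¬_)
  open import Relation.Binary.PropositionalEquality
  open Congruence
  open FiniteSums using (_⊕[_]_)

  rising : ℕ → ℕ → ℕ
  rising m zero    = 1
  rising m (suc k) = rising m k * (m + suc k)

  factorial-+ : ∀ m k → (m + k) ! ≡ m ! * rising m k
  factorial-+ m zero = trans (cong _! (ℕ.+-identityʳ m)) (sym (ℕ.*-identityʳ (m !)))
  factorial-+ m (suc k) = begin
    (m + suc k) !                      ≡⟨ cong _! (ℕ.+-suc m k) ⟩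
    suc (m + k) * (m + k) !            ≡⟨ cong (suc (m + k) *_) (factorial-+ m k) ⟩
    suc (m + k) * (m ! * rising m k)   ≡⟨ cong (_* (m ! * rising m k)) (sym (ℕ.+-suc m k)) ⟩
    (m + suc k) * (m ! * rising m k)   ≡⟨ rearrange (m + suc k) (m !) (rising m k) ⟩
    m ! * (rising m k * (m + suc k))   ∎
    where
    open ≡-Reasoning
    rearrange : ∀ a b c → a * (b * c) ≡ b * (c * a)
    rearrange = solve-∀

  factorialProduct : ∀ {k} → Vec ℕ k → ℕ
  factorialProduct = Vec.foldr (λ _ → ℕ) (λ x r → x ! * r) 1

  factorialProduct-nonZero : ∀ {k} (xs : Vec ℕ k) → ℕ.NonZero (factorialProduct xs)
  factorialProduct-nonZero []       = _
  factorialProduct-nonZero (x ∷ xs) =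
    ℕ.m*n≢0 (x !) (factorialProduct xs) {{x ℕ.!≢0}} {{factorialProduct-nonZero xs}}

  -- For p prime, write W = (p-1)!.  The
  -- factorial of r + sp with r < p splits as p^s · s! · U where U is prime to
  -- p and U ≡ W^s · r! (mod p); this is the factorial form of Lucas' theorem.
  module FactorialModPrime (p′ : ℕ) (pr : Prime (suc p′)) where

    p : ℕ
    p = suc p′
    open Mod p

    W : ℕ
    W = p′ !

    +multiple≈ : ∀ x s → x + s * p ≈ x
    +multiple≈ x s = mk≈ (subst ((+ p) ℤ.∣_) (sym difference) (ℤ.divides (+ s) refl))
      where
      cancel : ∀ (a b c : ℤ.ℤ) → (a ℤ.+ b ℤ.* c) ℤ.- a ≡ b ℤ.* c
      cancel = ℤ.solve-∀
      difference : + (x + s * p) ℤ.- + x ≡ + s ℤ.* + p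
      difference = trans (cong (ℤ._- + x) (trans (ℤ.pos-+ x (s * p)) (cong (λ t → + x ℤ.+ t) (ℤ.pos-* s p))))
                         (cancel (+ x) (+ s) (+ p))

    rising≈ : ∀ s k → rising (s * p) k ≈ k !
    rising≈ s zero    = ≈-refl
    rising≈ s (suc k) =
      ≈-trans (*-cong≈ (rising≈ s k) (≈-trans (≈-reflexive (ℕ.+-comm (s * p) (suc k))) (+multiple≈ (suc k) s)))
              (≈-reflexive (ℕ.*-comm (k !) (suc k)))

    -- the product of the factors of (sp)! that are prime to p
    unitPart : ℕ → ℕ
    unitPart zero    = 1
    unitPart (suc s) = unitPart s * rising (s * p) p′

    -- each block (sp+1)⋯(sp+p-1) contributes a factor ≡ (p-1)! = W
    unitPart≈ : ∀ s → unitPart s ≈ W ^ s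
    unitPart≈ zero    = ≈-refl
    unitPart≈ (suc s) =
      ≈-trans (*-cong≈ (unitPart≈ s) (rising≈ s p′)) (≈-reflexive (ℕ.*-comm (W ^ s) W))

    factorial-multiple : ∀ s → (s * p) ! ≡ p ^ s * s ! * unitPart s
    factorial-multiple zero    = refl
    factorial-multiple (suc s) = begin
      (p + s * p) !                                        ≡⟨ cong _! (ℕ.+-comm p (s * p)) ⟩
      (s * p + p) !                                        ≡⟨ factorial-+ (s * p) p ⟩
      (s * p) ! * (rising (s * p) p′ * (s * p + p))        ≡⟨ cong (_* (rising (s * p) p′ * (s * p + p))) (factorial-multiple s) ⟩
      p ^ s * s ! * unitPart s * (rising (s * p) p′ * (s * p + p))
                                                           ≡⟨ rearrange (p ^ s) (s !) (unitPart s) (rising (s * p) p′) s p ⟩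
      p * p ^ s * (suc s * s !) * (unitPart s * rising (s * p) p′) ∎
      where
      open ≡-Reasoning
      rearrange : ∀ a b c d s p → a * b * c * (d * (s * p + p)) ≡ p * a * ((1 + s) * b) * (c * d)
      rearrange = solve-∀

    p∤1 : ¬ (p ∣ 1)
    p∤1 p∣1 = ¬prime[1] (subst Prime (∣1⇒≡1 p∣1) pr)

    p∤* : ∀ {a b} → ¬ (p ∣ a) → ¬ (p ∣ b) → ¬ (p ∣ a * b)
    p∤* {a} {b} p∤a p∤b p∣ab with euclidsLemma a b pr p∣ab
    ... | inj₁ p∣a = p∤a p∣a
    ... | inj₂ p∣b = p∤b p∣b

    p∤^ : ∀ {a} n → ¬ (p ∣ a) → ¬ (p ∣ a ^ n)
    p∤^ zero    p∤a = p∤1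
    p∤^ (suc n) p∤a = p∤* p∤a (p∤^ n p∤a)

    p∤! : ∀ r → r < p → ¬ (p ∣ r !)
    p∤! zero    _   = p∤1
    p∤! (suc r) r<p = p∤* p∤suc (p∤! r (ℕ.<-trans (ℕ.n<1+n r) r<p))
      where
      p∤suc : ¬ (p ∣ suc r)
      p∤suc p∣ = ℕ.<-irrefl refl (ℕ.<-≤-trans r<p (∣⇒≤ p∣))

    p∤-resp-≈ : ∀ {a b} → a ≈ b → ¬ (p ∣ b) → ¬ (p ∣ a)
    p∤-resp-≈ a≈b p∤b p∣a = p∤b (≈0⇒∣ (≈-trans (≈-sym a≈b) (∣⇒≈0 p∣a)))

    factorialProduct-p∤ : ∀ {k} (xs : Vec ℕ k) → All (_< p) xs → ¬ (p ∣ factorialProduct xs)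
    factorialProduct-p∤ []       []          = p∤1
    factorialProduct-p∤ (x ∷ xs) (x<p ∷ xs<p) = p∤* (p∤! x x<p) (factorialProduct-p∤ xs xs<p)

    Splitting : ℕ → ℕ → ℕ → ℕ → Set
    Splitting n s s! r! = Σ ℕ λ U → (n ≡ p ^ s * s! * U) × (U ≈ W ^ s * r!) × ¬ (p ∣ U)

    factorial-split : ∀ r s → r < p → Splitting ((r + s * p) !) s (s !) (r !)
    factorial-split r s r<p = U , equation , U≈ , p∤U
      where
      U : ℕ
      U = unitPart s * rising (s * p) r
      equation : (r + s * p) ! ≡ p ^ s * s ! * U
      equation = begin
        (r + s * p) !                            ≡⟨ cong _! (ℕ.+-comm r (s * p)) ⟩
        (s * p + r) !                            ≡⟨ factorial-+ (s * p) r ⟩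
        (s * p) ! * rising (s * p) r             ≡⟨ cong (_* rising (s * p) r) (factorial-multiple s) ⟩
        p ^ s * s ! * unitPart s * rising (s * p) r ≡⟨ ℕ.*-assoc (p ^ s * s !) (unitPart s) _ ⟩
        p ^ s * s ! * U                          ∎
        where open ≡-Reasoning
      U≈ : U ≈ W ^ s * r !
      U≈ = *-cong≈ (unitPart≈ s) (rising≈ s r)
      p∤U : ¬ (p ∣ U)
      p∤U = p∤-resp-≈ U≈ (p∤* (p∤^ s (p∤! p′ (ℕ.n<1+n p′))) (p∤! r r<p))

    splitting-* : ∀ {m n} s S a A b B → Splitting m s a b → Splitting n S A B → Splitting (m * n) (s + S) (a * A) (b * B)
    splitting-* {m} {n} s S a A b B (U , m≡ , U≈ , p∤U) (V , n≡ , V≈ , p∤V) =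
      U * V , equation , UV≈ , p∤* p∤U p∤V
      where
      equation : m * n ≡ p ^ (s + S) * (a * A) * (U * V)
      equation = begin
        m * n                                  ≡⟨ cong₂ _*_ m≡ n≡ ⟩
        p ^ s * a * U * (p ^ S * A * V)        ≡⟨ rearrange (p ^ s) a U (p ^ S) A V ⟩
        p ^ s * p ^ S * (a * A) * (U * V)      ≡⟨ cong (λ t → t * (a * A) * (U * V)) (sym (ℕ.^-distribˡ-+-* p s S)) ⟩
        p ^ (s + S) * (a * A) * (U * V)        ∎
        where
        open ≡-Reasoning
        rearrange : ∀ a b c d e f → a * b * c * (d * e * f) ≡ a * d * (b * e) * (c * f)
        rearrange = solve-∀
      UV≈ : U * V ≈ W ^ (s + S) * (b * B)
      UV≈ = ≈-trans (*-cong≈ U≈ V≈)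
              (≈-reflexive (trans (rearrange (W ^ s) b (W ^ S) B) (cong (_* (b * B)) (sym (ℕ.^-distribˡ-+-* W s S)))))
        where
        rearrange : ∀ a b c d → a * b * (c * d) ≡ a * c * (b * d)
        rearrange = solve-∀

    factorialProduct-split : ∀ {k} (rs ss : Vec ℕ k) → All (_< p) rs →
      Splitting (factorialProduct (rs ⊕[ p ] ss)) (Vec.sum ss) (factorialProduct ss) (factorialProduct rs)
    factorialProduct-split []       []       []         = 1 , refl , ≈-refl , p∤1
    factorialProduct-split (r ∷ rs) (s ∷ ss) (r<p ∷ rs<p) =
      splitting-* s (Vec.sum ss) (s !) (factorialProduct ss) (r !) (factorialProduct rs)
        (factorial-split r s r<p) (factorialProduct-split rs ss rs<p)

module PrimePowers where

  open import Data.Nat as ℕ using (ℕ; zero; suc; _+_; _*_; _∸_; _≤_; _<_; z≤n; _^_)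
  import Data.Nat.Properties as ℕ
  open import Data.Nat.Divisibility as ∣ using (_∣_; divides)
  open import Data.Nat.DivMod using (_/_; n/1≡n; m/n/o≡m/[n*o])
  open import Data.Nat.Tactic.RingSolver using (solve-∀)
  open import Data.Nat.Primality
  open import Data.Nat.Primality.Factorisation using (factorise; PrimeFactorisation)
  open import Data.Nat.ListAction using (product)
  open import Data.List as List using (List)
  import Data.List.Relation.Unary.All as List
  open import Data.Vec as Vec using (Vec; []; _∷_)
  import Data.Vec.Properties as Vec
  open import Data.Product using (Σ; _×_; _,_)
  open import Data.Sum using (inj₁; inj₂)
  open import Data.Empty using (⊥-elim)
  open import Relation.Nullary using (yes; no; ¬_)
  open import Relation.Binary.PropositionalEquality
  open FiniteSums using (⊕-digits; %-bounded)
  open Factorials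

  power-cancel : ∀ {q} → Prime q → ∀ m {a U} → ¬ (q ∣ U) → q ^ m ∣ a * U → q ^ m ∣ a
  power-cancel pq zero    q∤U _ = ∣.1∣ _
  power-cancel {q} pq (suc m) {a} {U} q∤U q^m∣aU
    with euclidsLemma a U pq (∣.∣-trans (∣.m∣m*n (q ^ m)) q^m∣aU)
  ... | inj₂ q∣U = ⊥-elim (q∤U q∣U)
  ... | inj₁ (divides a′ refl) = subst (q ^ suc m ∣_) (ℕ.*-comm q a′) (∣.*-monoʳ-∣ q (power-cancel pq m q∤U q^m∣a′U))
    where
    instance _ = prime⇒nonZero pq
    regroup : ∀ x y z → x * y * z ≡ y * (x * z)
    regroup = solve-∀
    q^m∣a′U : q ^ m ∣ a′ * U
    q^m∣a′U = ∣.*-cancelˡ-∣ q (subst (q * q ^ m ∣_) (regroup a′ q U) q^m∣aU)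

  power-mono : ∀ q {a b} → a ≤ b → q ^ a ∣ q ^ b
  power-mono q {a} {b} a≤b = divides (q ^ (b ∸ a)) (begin
    q ^ b               ≡⟨ cong (q ^_) (sym (ℕ.m+[n∸m]≡n a≤b)) ⟩
    q ^ (a + (b ∸ a))   ≡⟨ ℕ.^-distribˡ-+-* q a (b ∸ a) ⟩
    q ^ a * q ^ (b ∸ a) ≡⟨ ℕ.*-comm (q ^ a) _ ⟩
    q ^ (b ∸ a) * q ^ a ∎)
    where open ≡-Reasoning

  PrimePowersDivide : ℕ → ℕ → Set
  PrimePowersDivide B A = ∀ q → Prime q → ∀ k → q ^ k ∣ B → q ^ k ∣ A

  private
    distinct-primes-∤ : ∀ {p q} → Prime p → Prime q → q ≢ p → ¬ (q ∣ p)
    distinct-primes-∤ pp pq q≢p q∣p with prime⇒irreducible pp q∣p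
    ... | inj₁ q≡1 = ¬prime[1] (subst Prime q≡1 pq)
    ... | inj₂ q≡p = q≢p q≡p

    product-divides : ∀ ps → List.All Prime ps → ∀ A → PrimePowersDivide (product ps) A → product ps ∣ A
    product-divides List.[]         _               A H = ∣.1∣ A
    product-divides (p List.∷ ps) (pp List.∷ pps) A H =
      subst (p * product ps ∣_) (sym A≡pA′) (∣.*-monoʳ-∣ p (product-divides ps pps A′ H′))
      where
      instance _ = prime⇒nonZero pp
      p∣A : p ∣ A
      p∣A = subst (_∣ A) (ℕ.*-identityʳ p)
              (H p pp 1 (subst (_∣ p * product ps) (sym (ℕ.*-identityʳ p)) (∣.m∣m*n (product ps))))
      A′ : ℕ
      A′ = ∣.quotient p∣A
      A≡pA′ : A ≡ p * A′
      A≡pA′ = ∣.m∣n⇒n≡m*quotient p∣A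
      H′ : PrimePowersDivide (product ps) A′
      H′ q pq k q^k∣ with q ℕ.≟ p
      ... | yes refl = ∣.*-cancelˡ-∣ p (subst (p * p ^ k ∣_) A≡pA′ (H p pp (suc k) (∣.*-monoʳ-∣ p q^k∣)))
      ... | no q≢p   = power-cancel pq k (distinct-primes-∤ pp pq q≢p)
                         (subst (q ^ k ∣_) (trans A≡pA′ (ℕ.*-comm p A′)) (H q pq k (∣.∣n⇒∣m*n p q^k∣)))

  prime-powers-divide⇒∣ : ∀ B .{{_ : ℕ.NonZero B}} A → PrimePowersDivide B A → B ∣ A
  prime-powers-divide⇒∣ B A H =
    subst (_∣ A) (sym B≡∏) (product-divides factors factorsPrime A (λ q pq k d → H q pq k (subst (q ^ k ∣_) (sym B≡∏) d)))
    where
    open PrimeFactorisation (factorise B)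
    B≡∏ : B ≡ product factors
    B≡∏ = isFactorisation

  -- every N > 0 is p^k · M with p ∤ M  (p > 1); the fuel bounds the number of
  -- factors p that can be split off
  prime-power-part : ∀ {p} → 1 < p → ∀ N → 0 < N → Σ ℕ λ k → Σ ℕ λ M → (N ≡ p ^ k * M) × ¬ (p ∣ M)
  prime-power-part {p} 1<p N = go N N ℕ.≤-refl
    where
    go : ∀ fuel N → N ≤ fuel → 0 < N → Σ ℕ λ k → Σ ℕ λ M → (N ≡ p ^ k * M) × ¬ (p ∣ M)
    go fuel N N≤fuel N>0 with p ∣.∣? N
    ... | no p∤N = 0 , N , sym (ℕ.+-identityʳ N) , p∤N
    go zero N N≤0 N>0 | yes _ = ⊥-elim (ℕ.<⇒≱ N>0 N≤0)
    go (suc fuel) N N≤fuel N>0 | yes (divides N′ refl) with go fuel N′ N′≤fuel N′>0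
      where
      N′>0 : 0 < N′
      N′>0 = ℕ.n≢0⇒n>0 (λ { refl → ℕ.<-irrefl refl N>0 })
      N′≤fuel : N′ ≤ fuel
      N′≤fuel = ℕ.≤-pred (ℕ.≤-trans (ℕ.m<m*n N′ p {{ℕ.>-nonZero N′>0}} 1<p) N≤fuel)
    ... | k , M , N′≡ , p∤M = suc k , M , trans (cong (_* p) N′≡) (regroup (p ^ k) M p) , p∤M
      where
      regroup : ∀ a M p → a * M * p ≡ p * a * M
      regroup = solve-∀

  -- For p prime let
  -- σₗ(x) = Σᵢ ⌊xᵢ/pˡ⌋.  The proof
  -- peels off p^σ₁ using ∏ xᵢ! = p^σ₁(x) · ∏ ⌊xᵢ/p⌋! · U with p ∤ U and
  -- recurses on ⌊x/p⌋, ⌊y/p⌋.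
  module Landau (p′ : ℕ) (pr : Prime (suc p′)) where
    open FactorialModPrime p′ pr using (p; p∤1; factorialProduct-split)

    infixl 7 _/p^_
    _/p^_ : ℕ → ℕ → ℕ
    x /p^ ℓ = (x / p ^ ℓ) {{ℕ.m^n≢0 p ℓ}}

    σ : ℕ → ∀ {k} → Vec ℕ k → ℕ
    σ ℓ xs = Vec.sum (Vec.map (_/p^ ℓ) xs)

    σ-suc : ∀ ℓ {k} (xs : Vec ℕ k) → σ ℓ (Vec.map (_/ p) xs) ≡ σ (suc ℓ) xs
    σ-suc ℓ xs = cong Vec.sum (trans (sym (Vec.map-∘ (_/p^ ℓ) (_/ p) xs))
      (Vec.map-cong (λ x → m/n/o≡m/[n*o] x p (p ^ ℓ) {{_}} {{ℕ.m^n≢0 p ℓ}} {{ℕ.m^n≢0 p (suc ℓ)}}) xs))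

    σ-one : ∀ {k} (xs : Vec ℕ k) → σ 1 xs ≡ Vec.sum (Vec.map (_/ p) xs)
    σ-one xs = trans (sym (σ-suc 0 xs)) (cong Vec.sum (trans (sym (Vec.map-∘ (_/p^ 0) (_/ p) xs))
                       (Vec.map-cong (λ x → n/1≡n (x / p)) xs)))

    factorialProduct-p-part : ∀ {k} (xs : Vec ℕ k) → Σ ℕ λ U →
      (factorialProduct xs ≡ p ^ σ 1 xs * factorialProduct (Vec.map (_/ p) xs) * U) × ¬ (p ∣ U)
    factorialProduct-p-part xs
      with factorialProduct-split (Vec.map (ℕ._% p) xs) (Vec.map (_/ p) xs) (%-bounded p xs)
    ... | U , eq , _ , p∤U = U , equation , p∤U
      where
      equation : factorialProduct xs ≡ p ^ σ 1 xs * factorialProduct (Vec.map (_/ p) xs) * U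
      equation = trans (cong factorialProduct (sym (⊕-digits p xs)))
                       (trans eq (cong (λ s → p ^ s * factorialProduct (Vec.map (_/ p) xs) * U) (sym (σ-one xs))))

    factorialProduct-of-zeros : ∀ {k} (xs : Vec ℕ k) → Vec.sum xs ≡ 0 → factorialProduct xs ≡ 1
    factorialProduct-of-zeros []       _  = refl
    factorialProduct-of-zeros (x ∷ xs) eq rewrite ℕ.m+n≡0⇒m≡0 x eq =
      trans (ℕ.+-identityʳ _) (factorialProduct-of-zeros xs (ℕ.m+n≡0⇒n≡0 x eq))

    LandauHypothesis : ∀ {u v} → ℕ → Vec ℕ u → Vec ℕ v → Set
    LandauHypothesis t xs ys = (∀ ℓ → σ (suc ℓ) ys ≤ σ (suc ℓ) xs) × (σ 1 ys + t ≤ σ 1 xs)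

    LandauHypothesis-descend : ∀ {u v t} {xs : Vec ℕ u} {ys : Vec ℕ v} →
      LandauHypothesis t xs ys → LandauHypothesis 0 (Vec.map (_/ p) xs) (Vec.map (_/ p) ys)
    LandauHypothesis-descend {xs = xs} {ys} (H , _) = H′ , subst₂ _≤_ (sym (ℕ.+-identityʳ _)) refl (H′ 0)
      where
      H′ : ∀ ℓ → σ (suc ℓ) (Vec.map (_/ p) ys) ≤ σ (suc ℓ) (Vec.map (_/ p) xs)
      H′ ℓ = subst₂ _≤_ (sym (σ-suc (suc ℓ) ys)) (sym (σ-suc (suc ℓ) xs)) (H (suc ℓ))

    descend-power : ∀ {k v} (ys : Vec ℕ v) → σ 1 ys ≤ k → p ^ k ∣ factorialProduct ys →
      p ^ (k ∸ σ 1 ys) ∣ factorialProduct (Vec.map (_/ p) ys)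
    descend-power {k} ys Y≤k p^k∣ with factorialProduct-p-part ys
    ... | U , ∏y!≡ , p∤U = power-cancel pr (k ∸ Y) p∤U (∣.*-cancelˡ-∣ (p ^ Y) {{ℕ.m^n≢0 p Y}} p^Y*p^[k-Y]∣)
      where
      Y : ℕ
      Y = σ 1 ys
      A : ℕ
      A = factorialProduct (Vec.map (_/ p) ys)
      p^Y*p^[k-Y]∣ : p ^ Y * p ^ (k ∸ Y) ∣ p ^ Y * (A * U)
      p^Y*p^[k-Y]∣ = subst₂ _∣_ (trans (cong (p ^_) (sym (ℕ.m+[n∸m]≡n Y≤k))) (ℕ.^-distribˡ-+-* p Y (k ∸ Y)))
                                (trans ∏y!≡ (ℕ.*-assoc (p ^ Y) A U)) p^k∣

    ascend-power : ∀ {u} (xs : Vec ℕ u) {k t Y j} → Y + t ≤ σ 1 xs → k ≤ Y + j →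
      p ^ j ∣ factorialProduct (Vec.map (_/ p) xs) → p ^ (k + t) ∣ factorialProduct xs
    ascend-power xs {k} {t} {Y} {j} Y+t≤X k≤Y+j p^j∣ with factorialProduct-p-part xs
    ... | U , ∏x!≡ , _ = subst (p ^ (k + t) ∣_) (sym ∏x!≡) (∣.∣m⇒∣m*n U (∣.∣-trans (power-mono p k+t≤) p^[Y+t+j]∣))
      where
      X : ℕ
      X = σ 1 xs
      A : ℕ
      A = factorialProduct (Vec.map (_/ p) xs)
      regroup : ∀ Y j t → Y + j + t ≡ Y + t + j
      regroup = solve-∀
      k+t≤ : k + t ≤ Y + t + j
      k+t≤ = subst (k + t ≤_) (regroup Y j t) (ℕ.+-monoˡ-≤ t k≤Y+j)
      p^[Y+t+j]∣ : p ^ (Y + t + j) ∣ p ^ X * A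
      p^[Y+t+j]∣ = subst (_∣ p ^ X * A) (sym (ℕ.^-distribˡ-+-* p (Y + t) j)) (∣.*-pres-∣ (power-mono p Y+t≤X) p^j∣)

    landau : ∀ k t {u v} (xs : Vec ℕ u) (ys : Vec ℕ v) → LandauHypothesis t xs ys →
      p ^ k ∣ factorialProduct ys → p ^ (k + t) ∣ factorialProduct xs
    landau k t xs ys = bounded k k t xs ys ℕ.≤-refl
      where
      -- induction on the exponent k, with fuel bounding it: either p^k is
      -- covered by p^σ₁(y), or the excess j = k - σ₁(y) < k passes to ⌊x/p⌋, ⌊y/p⌋
      bounded : ∀ fuel k t {u v} (xs : Vec ℕ u) (ys : Vec ℕ v) → k ≤ fuel → LandauHypothesis t xs ys →
        p ^ k ∣ factorialProduct ys → p ^ (k + t) ∣ factorialProduct xs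
      bounded fuel k t xs ys k≤fuel hyp@(_ , Y+t≤X) p^k∣∏y! with k ℕ.≤? σ 1 ys
      ... | yes k≤Y = ascend-power xs {j = 0} Y+t≤X (ℕ.≤-trans k≤Y (ℕ.m≤m+n _ 0)) (∣.1∣ _)
      ... | no  k≰Y = ascend-power xs {j = j} Y+t≤X (ℕ.≤-reflexive (sym (ℕ.m+[n∸m]≡n (ℕ.<⇒≤ Y<k)))) (excess fuel k≤fuel)
        where
        Y : ℕ
        Y = σ 1 ys
        j : ℕ
        j = k ∸ Y
        Y<k : Y < k
        Y<k = ℕ.≰⇒> k≰Y
        p^j∣ : p ^ j ∣ factorialProduct (Vec.map (_/ p) ys)
        p^j∣ = descend-power ys (ℕ.<⇒≤ Y<k) p^k∣∏y!
        excess : ∀ fuel → k ≤ fuel → p ^ j ∣ factorialProduct (Vec.map (_/ p) xs)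
        excess zero       k≤0 = ⊥-elim (ℕ.<⇒≱ Y<k (ℕ.≤-trans k≤0 z≤n))
        excess (suc fuel) k≤fuel with Y ℕ.≟ 0
        ... | yes Y≡0 = ⊥-elim (p∤1 (∣.∣-trans p∣p^j p^j∣1))
          where
          -- with σ₁(y) = 0 all ⌊yⱼ/p⌋ vanish, so p^j ∣ 1 although j ≥ 1
          j≥1 : 1 ≤ j
          j≥1 = ℕ.m<n⇒0<n∸m Y<k
          p∣p^j : p ∣ p ^ j
          p∣p^j = subst (p ∣_) (cong (p ^_) (ℕ.m+[n∸m]≡n j≥1)) (∣.m∣m*n (p ^ (j ∸ 1)))
          p^j∣1 : p ^ j ∣ 1
          p^j∣1 = subst (p ^ j ∣_) (factorialProduct-of-zeros (Vec.map (_/ p) ys) (trans (sym (σ-one ys)) Y≡0)) p^j∣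
        ... | no Y≢0 = subst (λ e → p ^ e ∣ factorialProduct (Vec.map (_/ p) xs)) (ℕ.+-identityʳ j)
                         (bounded fuel j 0 (Vec.map (_/ p) xs) (Vec.map (_/ p) ys) j≤fuel
                            (LandauHypothesis-descend {xs = xs} {ys} hyp) p^j∣)
          where
          j≤fuel : j ≤ fuel
          j≤fuel = ℕ.≤-pred (ℕ.≤-trans (ℕ.∸-monoʳ-< (ℕ.n≢0⇒n>0 Y≢0) (ℕ.<⇒≤ Y<k)) k≤fuel)

module LinearForms where

  open import Data.Nat as ℕ using (ℕ; zero; suc; _+_; _*_; _≤_; _<_; z≤n)
  import Data.Nat.Properties as ℕ
  open import Data.Nat.DivMod using (_/_; +-distrib-/-∣ʳ; m*n/n≡m; m<n⇒m/n≡0)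
  open import Data.Nat.Divisibility using (n∣m*n)
  open import Data.Nat.Tactic.RingSolver using (solve-∀)
  open import Data.Vec as Vec using (Vec; []; _∷_; lookup)
  open import Data.Fin as Fin using (Fin)
  import Data.Fin.Properties as Fin
  open import Data.Vec.Relation.Unary.All using (All)
  open import Data.Vec.Relation.Unary.All.Properties using (map⁺; lookup⁻)
  open import Data.Product using (Σ; _,_)
  open import Data.Sum using (_⊎_; inj₁; inj₂)
  open import Data.Empty using (⊥-elim)
  open import Relation.Nullary using (Dec; yes; no; ¬_)
  open import Relation.Nullary.Decidable using (_⊎-dec_)
  open import Relation.Binary.PropositionalEquality
  open import Defs using (Tuple; dotℕ; ∣_∣ᵥ; tupleSum; OneAdmissible)
  open FiniteSums using (_⊕[_]_)

  values : ∀ {d w} → Tuple d w → Vec ℕ d → Vec ℕ w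
  values e n = Vec.map (λ a → dotℕ a n) e

  floorSum : ∀ {d w} → Tuple d w → (P : ℕ) .{{_ : ℕ.NonZero P}} → Vec ℕ d → ℕ
  floorSum e P n = Vec.sum (Vec.map (λ a → dotℕ a n / P) e)

  dot-⊕ : ∀ {d} P (a c b : Vec ℕ d) → dotℕ a (c ⊕[ P ] b) ≡ dotℕ a c + dotℕ a b * P
  dot-⊕ P []      []      []      = refl
  dot-⊕ P (k ∷ a) (x ∷ c) (y ∷ b) =
    trans (cong (k * (x + y * P) +_) (dot-⊕ P a c b)) (regroup k x y P (dotℕ a c) (dotℕ a b))
    where
    regroup : ∀ k x y P s t → k * (x + y * P) + (s + t * P) ≡ k * x + s + (k * y + t) * P
    regroup = solve-∀

  ∣⊕∣ : ∀ {d} P (c b : Vec ℕ d) → ∣ c ⊕[ P ] b ∣ᵥ ≡ ∣ c ∣ᵥ + ∣ b ∣ᵥ * P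
  ∣⊕∣ P []      []      = refl
  ∣⊕∣ P (x ∷ c) (y ∷ b) = trans (cong (x + y * P +_) (∣⊕∣ P c b)) (regroup x y P ∣ c ∣ᵥ ∣ b ∣ᵥ)
    where
    regroup : ∀ x y P s t → x + y * P + (s + t * P) ≡ x + s + (y + t) * P
    regroup = solve-∀

  values-⊕ : ∀ {d w} (e : Tuple d w) P c b → values e (c ⊕[ P ] b) ≡ values e c ⊕[ P ] values e b
  values-⊕ []      P c b = refl
  values-⊕ (a ∷ e) P c b = cong₂ _∷_ (dot-⊕ P a c b) (values-⊕ e P c b)

  sum-values : ∀ {d w} (e : Tuple d w) b → Vec.sum (values e b) ≡ dotℕ (tupleSum e) b
  sum-values []      b = sym (dot-zero b)
    where
    dot-zero : ∀ {d} (b : Vec ℕ d) → dotℕ (Vec.replicate d 0) b ≡ 0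
    dot-zero []      = refl
    dot-zero (_ ∷ b) = dot-zero b
  sum-values (a ∷ e) b = trans (cong (dotℕ a b +_) (sum-values e b)) (sym (dot-+ a (tupleSum e) b))
    where
    dot-+ : ∀ {d} (a a′ b : Vec ℕ d) → dotℕ (Vec.zipWith _+_ a a′) b ≡ dotℕ a b + dotℕ a′ b
    dot-+ []      []        []      = refl
    dot-+ (x ∷ a) (x′ ∷ a′) (y ∷ b) =
      trans (cong ((x + x′) * y +_) (dot-+ a a′ b)) (regroup x x′ y (dotℕ a b) (dotℕ a′ b))
      where
      regroup : ∀ x x′ y s t → (x + x′) * y + (s + t) ≡ x * y + s + (x′ * y + t)
      regroup = solve-∀

  balanced-values : ∀ {d u v} (e : Tuple d u) (f : Tuple d v) → tupleSum e ≡ tupleSum f →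
    ∀ b → Vec.sum (values e b) ≡ Vec.sum (values f b)
  balanced-values e f |e|≡|f| b =
    trans (sum-values e b) (trans (cong (λ t → dotℕ t b) |e|≡|f|) (sym (sum-values f b)))

  floorSum-⊕ : ∀ {d w} (e : Tuple d w) P .{{_ : ℕ.NonZero P}} c b →
    floorSum e P (c ⊕[ P ] b) ≡ floorSum e P c + Vec.sum (values e b)
  floorSum-⊕ []      P c b = refl
  floorSum-⊕ (a ∷ e) P c b = begin
    dotℕ a (c ⊕[ P ] b) / P + floorSum e P (c ⊕[ P ] b)
      ≡⟨ cong₂ _+_ (cong (_/ P) (dot-⊕ P a c b)) (floorSum-⊕ e P c b) ⟩
    (dotℕ a c + dotℕ a b * P) / P + (floorSum e P c + Vec.sum (values e b))
      ≡⟨ cong (_+ (floorSum e P c + Vec.sum (values e b))) (+-multiple-/ (dotℕ a c) (dotℕ a b)) ⟩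
    dotℕ a c / P + dotℕ a b + (floorSum e P c + Vec.sum (values e b))
      ≡⟨ interchange (dotℕ a c / P) (dotℕ a b) (floorSum e P c) (Vec.sum (values e b)) ⟩
    dotℕ a c / P + floorSum e P c + (dotℕ a b + Vec.sum (values e b))
      ∎
    where
    open ≡-Reasoning
    +-multiple-/ : ∀ x y → (x + y * P) / P ≡ x / P + y
    +-multiple-/ x y = trans (+-distrib-/-∣ʳ x (n∣m*n y)) (cong (x / P +_) (m*n/n≡m y P))
    interchange : ∀ a b c d → a + b + (c + d) ≡ a + c + (b + d)
    interchange = solve-∀

  floorSum-small : ∀ {d w} (e : Tuple d w) P .{{_ : ℕ.NonZero P}} c →
    (∀ i → dotℕ (lookup e i) c < P) → floorSum e P c ≡ 0
  floorSum-small []      P c small = refl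
  floorSum-small (a ∷ e) P c small =
    cong₂ _+_ (m<n⇒m/n≡0 (small Fin.zero)) (floorSum-small e P c (λ i → small (Fin.suc i)))

  -- Some value eᵢ·c or fⱼ·c reaches P.  For c ∈ [0,P)^d this says that the
  -- grid point c/P lies in D_{e,f}.
  Reaches : ∀ {d u v} → Tuple d u → Tuple d v → ℕ → Vec ℕ d → Set
  Reaches {u = u} {v} e f P c =
    (Σ (Fin u) λ i → P ≤ dotℕ (lookup e i) c) ⊎ (Σ (Fin v) λ j → P ≤ dotℕ (lookup f j) c)

  reaches? : ∀ {d u v} (e : Tuple d u) (f : Tuple d v) P c → Dec (Reaches e f P c)
  reaches? e f P c = Fin.any? (λ i → P ℕ.≤? dotℕ (lookup e i) c) ⊎-dec Fin.any? (λ j → P ℕ.≤? dotℕ (lookup f j) c)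

  module _ {d u v} (e : Tuple d u) (f : Tuple d v) (P : ℕ) (c : Vec ℕ d) (¬reach : ¬ Reaches e f P c) where

    values-belowᵉ : All (_< P) (values e c)
    values-belowᵉ = map⁺ (lookup⁻ (λ i → ℕ.≰⇒> (λ P≤ → ¬reach (inj₁ (i , P≤)))))

    values-belowᶠ : All (_< P) (values f c)
    values-belowᶠ = map⁺ (lookup⁻ (λ j → ℕ.≰⇒> (λ P≤ → ¬reach (inj₂ (j , P≤)))))

    floorSum-unreached : .{{_ : ℕ.NonZero P}} → floorSum f P c ≡ floorSum e P c
    floorSum-unreached = trans (floorSum-small f P c (λ j → ℕ.≰⇒> (λ P≤ → ¬reach (inj₂ (j , P≤)))))
                               (sym (floorSum-small e P c (λ i → ℕ.≰⇒> (λ P≤ → ¬reach (inj₁ (i , P≤))))))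

  private
    dot-≥-∣∣ : ∀ {d} (x a : Vec ℕ d) → (∀ k → 1 ≤ lookup x k) → ∣ a ∣ᵥ ≤ dotℕ x a
    dot-≥-∣∣ []      []      _  = z≤n
    dot-≥-∣∣ (k ∷ x) (y ∷ a) x≥1 = ℕ.+-mono-≤ (y≤k*y (x≥1 Fin.zero)) (dot-≥-∣∣ x a (λ i → x≥1 (Fin.suc i)))
      where
      y≤k*y : 1 ≤ k → y ≤ k * y
      y≤k*y 1≤k = ℕ.m≤n*m y k {{ℕ.>-nonZero 1≤k}}

    dot-≥-term : ∀ {d} (x a : Vec ℕ d) k → lookup x k * lookup a k ≤ dotℕ x a
    dot-≥-term (k ∷ x) (y ∷ a) Fin.zero    = ℕ.m≤m+n (k * y) _
    dot-≥-term (k ∷ x) (y ∷ a) (Fin.suc i) = ℕ.≤-trans (dot-≥-term x a i) (ℕ.m≤n+m _ (k * y))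

    largest-coordinate : ∀ {d} (a : Vec ℕ (suc d)) → Σ (Fin (suc d)) λ k → ∣ a ∣ᵥ ≤ suc d * lookup a k
    largest-coordinate {zero}  (y ∷ []) = Fin.zero , ℕ.≤-refl
    largest-coordinate {suc d} (y ∷ a) with largest-coordinate a
    ... | k , |a|≤ with y ℕ.≤? lookup a k
    ...   | yes y≤aₖ = Fin.suc k , ℕ.+-mono-≤ y≤aₖ |a|≤
    ...   | no  y≰aₖ = Fin.zero , ℕ.+-monoʳ-≤ y (ℕ.≤-trans |a|≤ (ℕ.*-monoʳ-≤ (suc d) (ℕ.<⇒≤ (ℕ.≰⇒> y≰aₖ))))

  admissible⇒large-value : ∀ d {u} (e : Tuple d u) → OneAdmissible e → ∀ p (a : Vec ℕ d) → 0 < p → p ≤ ∣ a ∣ᵥ →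
    Σ (Fin u) λ i → p ≤ dotℕ (lookup e i) a
  admissible⇒large-value d e (inj₁ (i , eᵢ≥1)) p a _ p≤|a| = i , ℕ.≤-trans p≤|a| (dot-≥-∣∣ (lookup e i) a eᵢ≥1)
  admissible⇒large-value zero    e (inj₂ _) p [] p>0 p≤0 = ⊥-elim (ℕ.<⇒≱ p>0 p≤0)
  admissible⇒large-value (suc d) e (inj₂ H) p a _ p≤|a| with largest-coordinate a
  ... | k , |a|≤ with H k
  ...   | i , eᵢₖ≥d = i , ℕ.≤-trans p≤|a| (ℕ.≤-trans |a|≤
                        (ℕ.≤-trans (ℕ.*-monoˡ-≤ (lookup a k) eᵢₖ≥d) (dot-≥-term (lookup e i) a k)))

module Rationals where

  open import Data.Nat as ℕ using (ℕ; suc)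
  import Data.Nat.Properties as ℕ
  open import Data.Nat.DivMod using (m*n/o*n≡m/o; /-congʳ)
  open import Data.Integer as ℤ using (ℤ; +_; -[1+_]; +≤+; +<+)
  import Data.Integer.Properties as ℤ
  import Data.Integer.Tactic.RingSolver as ℤ
  open import Data.Rational as ℚ using (ℚ; mkℚ; _/_; floor; toℚᵘ)
  import Data.Rational.Properties as ℚ
  open import Data.Rational.Unnormalised as ℚᵘ using (ℚᵘ; mkℚᵘ; *≡*; *≤*; *<*)
  import Data.Rational.Unnormalised.Properties as ℚᵘ
  open import Relation.Binary.PropositionalEquality

  -- Computations with rationals are done on unnormalised representatives,
  -- where a fraction i/(n+1) is literally mkℚᵘ i n.

  toℚᵘ-/ : ∀ i n → toℚᵘ (i / suc n) ℚᵘ.≃ mkℚᵘ i n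
  toℚᵘ-/ i n = ℚ.toℚᵘ-fromℚᵘ (mkℚᵘ i n)

  toℚᵘ-/′ : ∀ i m .{{_ : ℕ.NonZero m}} → toℚᵘ (i / m) ℚᵘ.≃ (i ℚᵘ./ m)
  toℚᵘ-/′ i (suc m) = toℚᵘ-/ i m

  ≤-via-ℚᵘ : ∀ {x y : ℚ} {a b : ℚᵘ} → toℚᵘ x ℚᵘ.≃ a → toℚᵘ y ℚᵘ.≃ b → a ℚᵘ.≤ b → x ℚ.≤ y
  ≤-via-ℚᵘ x≃a y≃b a≤b = ℚ.toℚᵘ-cancel-≤ (ℚᵘ.≤-respʳ-≃ (ℚᵘ.≃-sym y≃b) (ℚᵘ.≤-respˡ-≃ (ℚᵘ.≃-sym x≃a) a≤b))

  <-via-ℚᵘ : ∀ {x y : ℚ} {a b : ℚᵘ} → toℚᵘ x ℚᵘ.≃ a → toℚᵘ y ℚᵘ.≃ b → a ℚᵘ.< b → x ℚ.< y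
  <-via-ℚᵘ x≃a y≃b a<b = ℚ.toℚᵘ-cancel-< (ℚᵘ.<-respʳ-≃ (ℚᵘ.≃-sym y≃b) (ℚᵘ.<-respˡ-≃ (ℚᵘ.≃-sym x≃a) a<b))

  fraction-≤ : ∀ a b m n → a ℕ.* suc n ℕ.≤ b ℕ.* suc m → mkℚᵘ (+ a) m ℚᵘ.≤ mkℚᵘ (+ b) n
  fraction-≤ a b m n h = *≤* (subst₂ ℤ._≤_ (ℤ.pos-* a (suc n)) (ℤ.pos-* b (suc m)) (+≤+ h))

  fraction-< : ∀ a b m n → a ℕ.* suc n ℕ.< b ℕ.* suc m → mkℚᵘ (+ a) m ℚᵘ.< mkℚᵘ (+ b) n
  fraction-< a b m n h = *<* (subst₂ ℤ._<_ (ℤ.pos-* a (suc n)) (ℤ.pos-* b (suc m)) (+<+ h))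

  *-+-fraction : ∀ (A B C : ℤ) n → (mkℚᵘ A 0 ℚᵘ.* mkℚᵘ B n) ℚᵘ.+ mkℚᵘ C n ℚᵘ.≃ mkℚᵘ (A ℤ.* B ℤ.+ C) n
  *-+-fraction A B C n = *≡* (begin
    ((A ℤ.* B) ℤ.* N ℤ.+ C ℤ.* + (1 ℕ.* suc n)) ℤ.* N
      ≡⟨ cong (λ t → ((A ℤ.* B) ℤ.* N ℤ.+ C ℤ.* t) ℤ.* N) (ℤ.pos-* 1 (suc n)) ⟩
    ((A ℤ.* B) ℤ.* N ℤ.+ C ℤ.* (+ 1 ℤ.* N)) ℤ.* N
      ≡⟨ normalise A B C N ⟩
    (A ℤ.* B ℤ.+ C) ℤ.* (+ 1 ℤ.* N ℤ.* N)
      ≡⟨ cong ((A ℤ.* B ℤ.+ C) ℤ.*_) (sym (trans (ℤ.pos-* (1 ℕ.* suc n) (suc n)) (cong (ℤ._* N) (ℤ.pos-* 1 (suc n))))) ⟩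
    (A ℤ.* B ℤ.+ C) ℤ.* + (1 ℕ.* suc n ℕ.* suc n)
      ∎)
    where
    open ≡-Reasoning
    N : ℤ
    N = + suc n
    normalise : ∀ A B C N → ((A ℤ.* B) ℤ.* N ℤ.+ C ℤ.* (+ 1 ℤ.* N)) ℤ.* N ≡ (A ℤ.* B ℤ.+ C) ℤ.* (+ 1 ℤ.* N ℤ.* N)
    normalise = ℤ.solve-∀

  *-fractions : ∀ a b x y .{{_ : ℕ.NonZero x}} .{{_ : ℕ.NonZero y}} →
    (+ a ℚᵘ./ x) ℚᵘ.* (+ b ℚᵘ./ y) ℚᵘ.≃ ((+ (a ℕ.* b)) ℚᵘ./ (x ℕ.* y)) {{ℕ.m*n≢0 x y}}
  *-fractions a b (suc x) (suc y) = ℚᵘ.≃-reflexive (cong (λ t → mkℚᵘ t (y ℕ.+ x ℕ.* suc y)) (sym (ℤ.pos-* a b)))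

  exact-quotient : ∀ E q F .{{_ : ℕ.NonZero F}} → E ≡ q ℕ.* F → ((+ E ℚᵘ./ 1) ℚᵘ.* (+ 1 ℚᵘ./ F)) ℚᵘ.≃ (+ q ℚᵘ./ 1)
  exact-quotient E q F@(suc _) E≡qF = ℚᵘ.≃-trans (*-fractions E 1 1 F) (*≡* (begin
    + (E ℕ.* 1) ℤ.* + 1     ≡⟨ sym (ℤ.pos-* (E ℕ.* 1) 1) ⟩
    + (E ℕ.* 1 ℕ.* 1)       ≡⟨ cong +_ (trans (ℕ.*-identityʳ (E ℕ.* 1)) (ℕ.*-identityʳ E)) ⟩
    + E                     ≡⟨ cong +_ (trans E≡qF (cong (q ℕ.*_) (sym (ℕ.*-identityˡ F)))) ⟩
    + (q ℕ.* (1 ℕ.* F))     ≡⟨ ℤ.pos-* q (1 ℕ.* F) ⟩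
    + q ℤ.* + (1 ℕ.* F)     ∎))
    where open ≡-Reasoning

  +-integers : ∀ a b → (+ a / 1) ℚ.+ (+ b / 1) ≡ + (a ℕ.+ b) / 1
  +-integers a b = ℚ.toℚᵘ-injective (ℚᵘ.≃-trans (ℚ.toℚᵘ-homo-+ (+ a / 1) (+ b / 1))
    (ℚᵘ.≃-trans (ℚᵘ.+-cong (toℚᵘ-/ (+ a) 0) (toℚᵘ-/ (+ b) 0))
    (ℚᵘ.≃-trans (*≡* (trans (normalise (+ a) (+ b)) (cong (ℤ._* + 1) (sym (ℤ.pos-+ a b)))))
    (ℚᵘ.≃-sym (toℚᵘ-/ (+ (a ℕ.+ b)) 0)))))
    where
    normalise : ∀ A B → (A ℤ.* + 1 ℤ.+ B ℤ.* + 1) ℤ.* + 1 ≡ (A ℤ.+ B) ℤ.* + 1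
    normalise = ℤ.solve-∀

  floor-fraction : ∀ (r : ℚ) m n → toℚᵘ r ℚᵘ.≃ mkℚᵘ (+ m) n → floor r ≡ + (m ℕ./ suc n)
  floor-fraction (mkℚ (+ a) D _) m n (*≡* eq) =
    trans (ℤ.*-identityˡ _) (cong +_ (begin
      a ℕ./ suc D                            ≡⟨ sym (m*n/o*n≡m/o a (suc n) (suc D)) ⟩
      a ℕ.* suc n ℕ./ (suc D ℕ.* suc n)      ≡⟨ cong (ℕ._/ (suc D ℕ.* suc n)) cross ⟩
      m ℕ.* suc D ℕ./ (suc D ℕ.* suc n)      ≡⟨ /-congʳ {m = m ℕ.* suc D} (ℕ.*-comm (suc D) (suc n)) ⟩
      m ℕ.* suc D ℕ./ (suc n ℕ.* suc D)      ≡⟨ m*n/o*n≡m/o m (suc D) (suc n) ⟩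
      m ℕ./ suc n                            ∎))
    where
    open ≡-Reasoning
    cross : a ℕ.* suc n ≡ m ℕ.* suc D
    cross = ℤ.+-injective (trans (ℤ.pos-* a (suc n)) (trans eq (sym (ℤ.pos-* m (suc D)))))
  floor-fraction (mkℚ -[1+ a ] D _) m n (*≡* eq) with trans eq (sym (ℤ.pos-* m (suc D)))
  ... | ()

module GridPoints where

  open import Data.Nat as ℕ using (ℕ; suc)
  import Data.Nat.Properties as ℕ
  open import Data.Integer as ℤ using (ℤ; +_)
  import Data.Integer.Properties as ℤ
  import Data.Integer.Tactic.RingSolver as ℤ
  open import Data.Rational as ℚ using (ℚ; _/_; 0ℚ; 1ℚ; floor; toℚᵘ)
  import Data.Rational.Properties as ℚ
  open import Data.Rational.Unnormalised as ℚᵘ using (mkℚᵘ; *≡*)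
  import Data.Rational.Unnormalised.Properties as ℚᵘ
  open import Data.Vec as Vec using (Vec; []; _∷_; lookup)
  import Data.Vec.Properties as Vec
  open import Data.Vec.Relation.Unary.All using (All)
  open import Data.Vec.Relation.Unary.All.Properties using (lookup⁺)
  open import Data.Product using (_×_; _,_)
  open import Data.Sum using (inj₁; inj₂)
  open import Relation.Binary.PropositionalEquality
  open import Defs using (Tuple; dotℕ; dotℚ; Δ; InUnitCube; InD)
  open Rationals
  open LinearForms using (floorSum; Reaches)

  -- The hypothesis on Δ is only ever used at the grid points c/P of [0,1)^d,
  -- c ∈ [0,P)^d.  There ⌊a·(c/P)⌋ = ⌊a·c/P⌋, so Δ becomes a difference of
  -- floor sums of natural numbers.
  module _ (P′ : ℕ) where

    P : ℕ
    P = suc P′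

    gridPoint : ∀ {d} → Vec ℕ d → Vec ℚ d
    gridPoint c = Vec.map (λ k → + k / P) c

    dotℚ-gridPoint : ∀ {d} (a c : Vec ℕ d) → toℚᵘ (dotℚ a (gridPoint c)) ℚᵘ.≃ mkℚᵘ (+ dotℕ a c) P′
    dotℚ-gridPoint []      []      = *≡* refl
    dotℚ-gridPoint (k ∷ a) (y ∷ c) =
      ℚᵘ.≃-trans (ℚ.toℚᵘ-homo-+ ((+ k / 1) ℚ.* (+ y / P)) (dotℚ a (gridPoint c)))
      (ℚᵘ.≃-trans (ℚᵘ.+-cong (ℚᵘ.≃-trans (ℚ.toℚᵘ-homo-* (+ k / 1) (+ y / P))
                                         (ℚᵘ.*-cong (toℚᵘ-/ (+ k) 0) (toℚᵘ-/ (+ y) P′)))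
                             (dotℚ-gridPoint a c))
      (ℚᵘ.≃-trans (*-+-fraction (+ k) (+ y) (+ dotℕ a c) P′)
                  (ℚᵘ.≃-reflexive (cong (λ t → mkℚᵘ t P′) numerator))))
      where
      numerator : + k ℤ.* + y ℤ.+ + dotℕ a c ≡ + (k ℕ.* y ℕ.+ dotℕ a c)
      numerator = trans (cong (ℤ._+ + dotℕ a c) (sym (ℤ.pos-* k y))) (sym (ℤ.pos-+ (k ℕ.* y) (dotℕ a c)))

    floor-dotℚ-gridPoint : ∀ {d} (a c : Vec ℕ d) → floor (dotℚ a (gridPoint c)) ≡ + (dotℕ a c ℕ./ P)
    floor-dotℚ-gridPoint a c = floor-fraction (dotℚ a (gridPoint c)) (dotℕ a c) P′ (dotℚ-gridPoint a c)

    one-≤-dotℚ-gridPoint : ∀ {d} (a c : Vec ℕ d) → P ℕ.≤ dotℕ a c → 1ℚ ℚ.≤ dotℚ a (gridPoint c)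
    one-≤-dotℚ-gridPoint a c P≤ =
      ≤-via-ℚᵘ (toℚᵘ-/ (+ 1) 0) (dotℚ-gridPoint a c)
        (fraction-≤ 1 (dotℕ a c) 0 P′ (subst₂ ℕ._≤_ (sym (ℕ.*-identityˡ P)) (sym (ℕ.*-identityʳ _)) P≤))

    gridPoint-in-cube : ∀ {d} (c : Vec ℕ d) → All (ℕ._< P) c → InUnitCube (gridPoint c)
    gridPoint-in-cube c c<P k =
      subst (λ t → (0ℚ ℚ.≤ t) × (t ℚ.< 1ℚ)) (sym (Vec.lookup-map k (λ k → + k / P) c))
        ( ≤-via-ℚᵘ (toℚᵘ-/ (+ 0) 0) (toℚᵘ-/ (+ y) P′) (fraction-≤ 0 y 0 P′ ℕ.z≤n)
        , <-via-ℚᵘ (toℚᵘ-/ (+ y) P′) (toℚᵘ-/ (+ 1) 0)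
            (fraction-< y 1 P′ 0 (subst₂ ℕ._<_ (sym (ℕ.*-identityʳ y)) (sym (ℕ.*-identityˡ P)) (lookup⁺ c<P k))))
      where
      y : ℕ
      y = lookup c k

    floors-at-gridPoint : ∀ {d w} (e : Tuple d w) (c : Vec ℕ d) →
      Vec.foldr (λ _ → ℤ) (λ a r → floor (dotℚ a (gridPoint c)) ℤ.+ r) (+ 0) e ≡ + floorSum e P c
    floors-at-gridPoint []      c = refl
    floors-at-gridPoint (a ∷ e) c =
      trans (cong₂ ℤ._+_ (floor-dotℚ-gridPoint a c) (floors-at-gridPoint e c))
            (sym (ℤ.pos-+ (dotℕ a c ℕ./ P) (floorSum e P c)))

    gridPoint-in-D : ∀ {d u v} (e : Tuple d u) (f : Tuple d v) (c : Vec ℕ d) →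
      All (ℕ._< P) c → Reaches e f P c → InD e f (gridPoint c)
    gridPoint-in-D e f c c<P (inj₁ (i , P≤)) = gridPoint-in-cube c c<P , inj₁ (i , one-≤-dotℚ-gridPoint (lookup e i) c P≤)
    gridPoint-in-D e f c c<P (inj₂ (j , P≤)) = gridPoint-in-cube c c<P , inj₂ (j , one-≤-dotℚ-gridPoint (lookup f j) c P≤)

    floorSum-gap : ∀ {d u v} (e : Tuple d u) (f : Tuple d v) →
      ((x : Vec ℚ d) → InD e f x → + 1 ℤ.≤ Δ e f x) →
      (c : Vec ℕ d) → All (ℕ._< P) c → Reaches e f P c →
      floorSum f P c ℕ.+ 1 ℕ.≤ floorSum e P c
    floorSum-gap e f Δ≥1 c c<P reach =
      ℤ.drop‿+≤+ (subst₂ ℤ._≤_ (trans (ℤ.+-comm (+ 1) (+ Y)) (sym (ℤ.pos-+ Y 1))) (cancel (+ X) (+ Y))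
                              (ℤ.+-monoˡ-≤ (+ Y) 1≤X-Y))
      where
      X : ℕ
      X = floorSum e P c
      Y : ℕ
      Y = floorSum f P c
      1≤X-Y : + 1 ℤ.≤ + X ℤ.- + Y
      1≤X-Y = subst (+ 1 ℤ.≤_) (cong₂ ℤ._-_ (floors-at-gridPoint e c) (floors-at-gridPoint f c)) (Δ≥1 (gridPoint c) (gridPoint-in-D e f c c<P reach))
      cancel : ∀ a b → a ℤ.- b ℤ.+ b ≡ a
      cancel = ℤ.solve-∀

module Integrality where

  open import Data.Nat as ℕ using (ℕ; zero; suc; _+_; _*_; _≤_; _<_; _^_)
  import Data.Nat.Properties as ℕ
  open import Data.Nat.Divisibility using (_∣_; quotient; m∣n⇒n≡quotient*m)
  open import Data.Nat.DivMod using (_/_; _%_)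
  open import Data.Nat.Primality using (Prime; ¬prime[0])
  open import Data.Integer as ℤ using (+_)
  open import Data.Rational using (ℚ)
  open import Data.Vec as Vec using (Vec)
  import Data.Vec.Properties as Vec
  open import Data.Vec.Relation.Unary.All using (All)
  open import Data.Product using (_,_)
  open import Data.Empty using (⊥-elim)
  open import Relation.Nullary using (yes; no)
  open import Relation.Binary.PropositionalEquality
  open import Defs using (Tuple; dotℕ; tupleSum; Δ; InD; compositions)
  open FiniteSums using (_⊕[_]_; ⊕-digits; %-bounded; listSum)
  open Factorials using (factorialProduct; factorialProduct-nonZero; module FactorialModPrime)
  open PrimePowers
  open LinearForms
  open GridPoints using (floorSum-gap)

  module Quotient {d u v} (e : Tuple d u) (f : Tuple d v) (balanced : tupleSum e ≡ tupleSum f)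
           (Δ≥1 : (x : Vec ℚ d) → InD e f x → + 1 ℤ.≤ Δ e f x) where

    E F : Vec ℕ d → ℕ
    E n = factorialProduct (values e n)
    F n = factorialProduct (values f n)

    -- on the box [0,P)^d: Δ(c/P) ≥ 1 on D_{e,f}, and both sums vanish off it
    floorSum-dominated-on-box : ∀ P′ c → All (_< suc P′) c → floorSum f (suc P′) c ≤ floorSum e (suc P′) c
    floorSum-dominated-on-box P′ c c<P with reaches? e f (suc P′) c
    ... | yes reach = ℕ.≤-trans (ℕ.m≤m+n _ 1) (floorSum-gap P′ e f Δ≥1 c c<P reach)
    ... | no ¬reach = ℕ.≤-reflexive (floorSum-unreached e f (suc P′) c ¬reach)

    -- translating n by a multiple Pb adds Σ eᵢ·b = Σ fⱼ·b to both floor sums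
    floorSum-dominated-⊕ : ∀ P .{{_ : ℕ.NonZero P}} c b → floorSum f P c ≤ floorSum e P c →
      floorSum f P (c ⊕[ P ] b) ≤ floorSum e P (c ⊕[ P ] b)
    floorSum-dominated-⊕ P c b f≤e = subst₂ _≤_ (sym (floorSum-⊕ f P c b)) (sym (floorSum-⊕ e P c b))
      (ℕ.+-mono-≤ f≤e (ℕ.≤-reflexive (sym (balanced-values e f balanced b))))

    floorSum-dominated : ∀ P .{{_ : ℕ.NonZero P}} n → floorSum f P n ≤ floorSum e P n
    floorSum-dominated P@(suc P′) n = subst (λ m → floorSum f P m ≤ floorSum e P m) (⊕-digits P n)
      (floorSum-dominated-⊕ P c (Vec.map (_/ P) n) (floorSum-dominated-on-box P′ c (%-bounded P n)))
      where
      c : Vec ℕ d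
      c = Vec.map (_% P) n

    module _ (p′ : ℕ) (pr : Prime (suc p′)) where
      open FactorialModPrime p′ pr using (p)
      open Landau p′ pr using (σ; _/p^_; landau)

      σ-values : ∀ {w} (g : Tuple d w) ℓ n → σ ℓ (values g n) ≡ floorSum g (p ^ ℓ) {{ℕ.m^n≢0 p ℓ}} n
      σ-values g ℓ n = cong Vec.sum (sym (Vec.map-∘ (_/p^ ℓ) (λ a → dotℕ a n) g))

      σ-dominated : ∀ ℓ n → σ ℓ (values f n) ≤ σ ℓ (values e n)
      σ-dominated ℓ n = subst₂ _≤_ (sym (σ-values f ℓ n)) (sym (σ-values e ℓ n))
                          (floorSum-dominated (p ^ ℓ) {{ℕ.m^n≢0 p ℓ}} n)

      landau-values : ∀ k t n → σ 1 (values f n) + t ≤ σ 1 (values e n) →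
        p ^ k ∣ F n → p ^ (k + t) ∣ E n
      landau-values k t n σ₁-gap = landau k t (values e n) (values f n) ((λ ℓ → σ-dominated (suc ℓ) n) , σ₁-gap)

    F∣E : ∀ n → F n ∣ E n
    F∣E n =
      prime-powers-divide⇒∣ (F n) {{factorialProduct-nonZero (values f n)}} (E n) prime-power
      where
      prime-power : PrimePowersDivide (F n) (E n)
      prime-power zero    pr = ⊥-elim (¬prime[0] pr)
      prime-power (suc p′) pr k p^k∣F = subst (λ m → suc p′ ^ m ∣ E n) (ℕ.+-identityʳ k)
        (landau-values p′ pr k 0 n (ℕ.≤-trans (ℕ.≤-reflexive (ℕ.+-identityʳ _)) (σ-dominated p′ pr 1 n)) p^k∣F)

    -- the integer value q(n) = Q_{e,f}(n) and the sums S(m) = Σ_{|n|=m} q(n);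
    -- q is kept abstract: only the equation E = qF is ever used, and
    -- unfolding the quotient would make type checking prohibitively slow
    abstract
      q : Vec ℕ d → ℕ
      q n = quotient (F∣E n)

      E≡q*F : ∀ n → E n ≡ q n * F n
      E≡q*F n = m∣n⇒n≡quotient*m (F∣E n)

    S : ℕ → ℕ
    S m = listSum (compositions d m) q

module Lucas where

  open import Data.Nat as ℕ using (ℕ; suc; _+_; _*_; _≤_; _<_; _^_; z≤n; s≤s)
  import Data.Nat.Properties as ℕ
  open import Data.Nat.Divisibility as ∣ using (_∣_)
  open import Data.Nat.DivMod using (_%_; [m+kn]%n≡m%n; m<n⇒m%n≡m)
  open import Data.Nat.Tactic.RingSolver using (solve-∀)
  open import Data.Nat.Primality using (Prime; ¬prime[1]; euclidsLemma)
  open import Data.Integer as ℤ using (+_)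
  open import Data.Rational using (ℚ)
  open import Data.Vec as Vec using (Vec; []; _∷_)
  import Data.Vec.Properties as Vec
  open import Data.Vec.Relation.Unary.All using (All)
  open import Data.Product using (_×_; _,_; proj₁; proj₂)
  open import Data.Sum using (inj₁; inj₂)
  open import Data.Empty using (⊥-elim)
  open import Relation.Nullary using (Dec; yes; no; ¬_)
  open import Relation.Binary.PropositionalEquality
  open import Defs using (Tuple; tupleSum; Δ; InD; OneAdmissible; ∣_∣ᵥ)
  open Congruence
  open FiniteSums
  open Factorials
  open PrimePowers using (prime-power-part; module Landau)
  open LinearForms
  open GridPoints using (floorSum-gap)
  open Integrality

  module LucasCongruence {d u v} (e : Tuple d u) (f : Tuple d v) (balanced : tupleSum e ≡ tupleSum f)
           (Δ≥1 : (x : Vec ℚ d) → InD e f x → + 1 ℤ.≤ Δ e f x) (admissible : OneAdmissible e)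
           (p′ : ℕ) (pr : Prime (suc p′)) where

    open FactorialModPrime p′ pr
    open Mod p
    open Landau p′ pr using (σ; σ-one)

    open Quotient e f balanced Δ≥1

    σ₁-gap : ∀ a b → All (_< p) a → Reaches e f p a → σ 1 (values f (a ⊕[ p ] b)) + 1 ≤ σ 1 (values e (a ⊕[ p ] b))
    σ₁-gap a b a<p reach = begin
      σ 1 (values f n) + 1        ≡⟨ cong (_+ 1) (σ₁-values f) ⟩
      floorSum f p a + Tf + 1     ≡⟨ cong (λ t → floorSum f p a + t + 1) (sym (balanced-values e f balanced b)) ⟩
      floorSum f p a + T + 1      ≡⟨ regroup (floorSum f p a) T ⟩
      floorSum f p a + 1 + T      ≤⟨ ℕ.+-monoˡ-≤ T (floorSum-gap p′ e f Δ≥1 a a<p reach) ⟩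
      floorSum e p a + T          ≡⟨ sym (σ₁-values e) ⟩
      σ 1 (values e n)            ∎
      where
      open ℕ.≤-Reasoning
      n : Vec ℕ d
      n = a ⊕[ p ] b
      T Tf : ℕ
      T  = Vec.sum (values e b)
      Tf = Vec.sum (values f b)
      σ₁-values : ∀ {w} (g : Tuple d w) → σ 1 (values g n) ≡ floorSum g p a + Vec.sum (values g b)
      σ₁-values g = trans (σ-one (values g n)) (trans (cong Vec.sum (sym (Vec.map-∘ _ _ g))) (floorSum-⊕ g p a b))
      regroup : ∀ x y → x + y + 1 ≡ x + 1 + y
      regroup = solve-∀

    p∣q-from-valuations : ∀ n k M → F n ≡ p ^ k * M → ¬ (p ∣ M) → p ^ (k + 1) ∣ E n → p ∣ q n
    p∣q-from-valuations n k M F≡ p∤M p^[k+1]∣E with euclidsLemma (q n) M pr p∣qM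
      where
      regroup : ∀ x y z → x * (y * z) ≡ y * (x * z)
      regroup = solve-∀
      p^k*p∣p^k*qM : p ^ k * p ∣ p ^ k * (q n * M)
      p^k*p∣p^k*qM = subst₂ _∣_ (trans (ℕ.^-distribˡ-+-* p k 1) (cong (p ^ k *_) (ℕ.*-identityʳ p)))
                                (trans (E≡q*F n) (trans (cong (q n *_) F≡) (regroup (q n) (p ^ k) M))) p^[k+1]∣E
      p∣qM : p ∣ q n * M
      p∣qM = ∣.*-cancelˡ-∣ (p ^ k) {{ℕ.m^n≢0 p k}} p^k*p∣p^k*qM
    ... | inj₁ p∣q = p∣q
    ... | inj₂ p∣M = ⊥-elim (p∤M p∣M)

    p∣q-reaching : ∀ a b → All (_< p) a → Reaches e f p a → p ∣ q (a ⊕[ p ] b)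
    p∣q-reaching a b a<p reach =
      let k , M , F≡ , p∤M = prime-power-part 1<p (F n) F>0
      in p∣q-from-valuations n k M F≡ p∤M
           (landau-values p′ pr k 1 n (σ₁-gap a b a<p reach) (∣.∣-trans (∣.m∣m*n M) (∣.∣-reflexive (sym F≡))))
      where
      n : Vec ℕ d
      n = a ⊕[ p ] b
      1<p : 1 < p
      1<p = s≤s (ℕ.n≢0⇒n>0 λ { refl → ¬prime[1] pr })
      F>0 : 0 < F n
      F>0 = ℕ.n≢0⇒n>0 (ℕ.≢-nonZero⁻¹ _ {{factorialProduct-nonZero (values f n)}})

    splitting-values : ∀ {w} (g : Tuple d w) a b → All (_< p) (values g a) →
      Splitting (factorialProduct (values g (a ⊕[ p ] b))) (Vec.sum (values g b))
                (factorialProduct (values g b)) (factorialProduct (values g a))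
    splitting-values g a b small =
      subst (λ m → Splitting m (Vec.sum (values g b)) (factorialProduct (values g b)) (factorialProduct (values g a)))
        (cong factorialProduct (sym (values-⊕ g p a b)))
      (factorialProduct-split (values g a) (values g b) small)

    unit-parts : ∀ n b T {U V} → E n ≡ p ^ T * E b * U → F n ≡ p ^ T * F b * V → q n * V ≡ q b * U
    unit-parts n b T {U} {V} E≡ F≡ = ℕ.*-cancelˡ-≡ (q n * V) (q b * U) (p ^ T * F b) (begin
      (p ^ T * F b) * (q n * V) ≡⟨ regroup₁ (p ^ T) (F b) (q n) V ⟩
      q n * (p ^ T * F b * V)   ≡⟨ cong (q n *_) (sym F≡) ⟩
      q n * F n                 ≡⟨ sym (E≡q*F n) ⟩
      E n                       ≡⟨ E≡ ⟩
      p ^ T * E b * U           ≡⟨ cong (λ t → p ^ T * t * U) (E≡q*F b) ⟩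
      p ^ T * (q b * F b) * U   ≡⟨ regroup₂ (p ^ T) (q b) (F b) U ⟩
      (p ^ T * F b) * (q b * U) ∎)
      where
      open ≡-Reasoning
      instance
        p^T*F[b]≢0 : ℕ.NonZero (p ^ T * F b)
        p^T*F[b]≢0 = ℕ.m*n≢0 (p ^ T) (F b) {{ℕ.m^n≢0 p T}} {{factorialProduct-nonZero (values f b)}}
      regroup₁ : ∀ a f q u → (a * f) * (q * u) ≡ q * (a * f * u)
      regroup₁ = solve-∀
      regroup₂ : ∀ a q f u → a * (q * f) * u ≡ (a * f) * (q * u)
      regroup₂ = solve-∀

    -- if no value at the low digits reaches p, q(a + pb) ≡ q(a) q(b): multiply
    -- by c = W^T F(a), which is prime to p, and compare unit parts
    q-multiplicative : ∀ a b → ¬ Reaches e f p a → q (a ⊕[ p ] b) ≈ q a * q b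
    q-multiplicative a b ¬reach
      with splitting-values e a b (values-belowᵉ e f p a ¬reach) | splitting-values f a b (values-belowᶠ e f p a ¬reach)
    ... | U , E≡ , U≈ , _ | V , F≡ , V≈ , _ = cancel≈ pr p∤c (begin
      c * q n                      ≡⟨ ℕ.*-comm c (q n) ⟩
      q n * c                      ≈⟨ *-cong≈ (≈-refl {q n}) (≈-sym V≈) ⟩
      q n * V                      ≡⟨ unit-parts n b T (subst (λ s → E n ≡ p ^ s * E b * U) Tₑ≡T E≡) F≡ ⟩
      q b * U                      ≈⟨ *-cong≈ (≈-refl {q b}) U≈ ⟩
      q b * (W ^ Tₑ * E a)         ≡⟨ cong (λ s → q b * (W ^ s * E a)) Tₑ≡T ⟩
      q b * (W ^ T * E a)          ≡⟨ cong (λ t → q b * (W ^ T * t)) (E≡q*F a) ⟩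
      q b * (W ^ T * (q a * F a))  ≡⟨ regroup (q b) (W ^ T) (q a) (F a) ⟩
      c * (q a * q b)              ∎)
      where
      open ≈-Reasoning
      n : Vec ℕ d
      n = a ⊕[ p ] b
      T Tₑ : ℕ
      T  = Vec.sum (values f b)
      Tₑ = Vec.sum (values e b)
      Tₑ≡T : Tₑ ≡ T
      Tₑ≡T = balanced-values e f balanced b
      c : ℕ
      c = W ^ T * F a
      p∤c : ¬ (p ∣ c)
      p∤c = p∤* (p∤^ T (p∤! p′ (ℕ.n<1+n p′))) (factorialProduct-p∤ (values f a) (values-belowᶠ e f p a ¬reach))
      regroup : ∀ qb w qa fa → qb * (w * (qa * fa)) ≡ w * fa * (qa * qb)
      regroup = solve-∀

    guard-cong≈ : ∀ {P : Set} (dP : Dec P) {x y} → x ≈ y → guard dP x ≈ guard dP y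
    guard-cong≈ (yes _) x≈y = x≈y
    guard-cong≈ (no _)  _   = ≈-refl

    guard-* : ∀ {P Q R : Set} (dP : Dec P) (dQ : Dec Q) (dR : Dec R) → (P → Q × R) → (Q → R → P) →
      ∀ x y → guard dP (x * y) ≡ guard dQ x * guard dR y
    guard-* (yes P) (yes _) (yes _) _ _ x y = refl
    guard-* (yes P) (yes _) (no ¬R) to _ x y = ⊥-elim (¬R (proj₂ (to P)))
    guard-* (yes P) (no ¬Q) _       to _ x y = ⊥-elim (¬Q (proj₁ (to P)))
    guard-* (no ¬P) (yes Q) (yes R) _ from x y = ⊥-elim (¬P (from Q R))
    guard-* (no _)  (yes _) (no _)  _ _ x y = sym (ℕ.*-zeroʳ x)
    guard-* (no _)  (no _)  _       _ _ x y = refl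

    low-digit-unique : ∀ {x w y N} → x < p → w < p → x + y * p ≡ w + N * p → x ≡ w
    low-digit-unique {x} {w} {y} {N} x<p w<p eq = begin
      x                ≡⟨ sym (m<n⇒m%n≡m x<p) ⟩
      x % p            ≡⟨ sym ([m+kn]%n≡m%n x y p) ⟩
      (x + y * p) % p  ≡⟨ cong (_% p) eq ⟩
      (w + N * p) % p  ≡⟨ [m+kn]%n≡m%n w N p ⟩
      w % p            ≡⟨ m<n⇒m%n≡m w<p ⟩
      w                ∎
      where open ≡-Reasoning

    level-⊕ : ∀ (a b : Vec ℕ d) w N → ∣ a ∣ᵥ < p → w < p →
      ∣ a ⊕[ p ] b ∣ᵥ ≡ w + N * p → (∣ a ∣ᵥ ≡ w) × (∣ b ∣ᵥ ≡ N)
    level-⊕ a b w N |a|<p w<p level≡ = |a|≡w , |b|≡N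
      where
      digits≡ : ∣ a ∣ᵥ + ∣ b ∣ᵥ * p ≡ w + N * p
      digits≡ = trans (sym (∣⊕∣ p a b)) level≡
      |a|≡w : ∣ a ∣ᵥ ≡ w
      |a|≡w = low-digit-unique {y = ∣ b ∣ᵥ} {N} |a|<p w<p digits≡
      |b|≡N : ∣ b ∣ᵥ ≡ N
      |b|≡N = ℕ.*-cancelʳ-≡ ∣ b ∣ᵥ N p (ℕ.+-cancelˡ-≡ w _ _ (trans (cong (_+ ∣ b ∣ᵥ * p) (sym |a|≡w)) digits≡))

    zeros : Vec ℕ d
    zeros = Vec.replicate d 0

    ⊕-zeros : ∀ {k} (a : Vec ℕ k) → a ⊕[ p ] Vec.replicate k 0 ≡ a
    ⊕-zeros []      = refl
    ⊕-zeros (x ∷ a) = cong₂ _∷_ (ℕ.+-identityʳ x) (⊕-zeros a)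

    level-term : ∀ w N (a b : Vec ℕ d) → w < p → All (_< p) a →
      atLevel (w + N * p) (a ⊕[ p ] b) (q (a ⊕[ p ] b)) ≈ atLevel w a (q a) * atLevel N b (q b)
    level-term w N a b w<p a<p with reaches? e f p a
    ... | yes reach = begin
      atLevel (w + N * p) (a ⊕[ p ] b) (q (a ⊕[ p ] b)) ≈⟨ guard-cong≈ (∣ a ⊕[ p ] b ∣ᵥ ℕ.≟ w + N * p) (∣⇒≈0 (p∣q-reaching a b a<p reach)) ⟩
      guard (∣ a ⊕[ p ] b ∣ᵥ ℕ.≟ w + N * p) 0          ≡⟨ guard-0 (∣ a ⊕[ p ] b ∣ᵥ ℕ.≟ w + N * p) ⟩
      0                                                 ≡⟨ sym (cong (_* atLevel N b (q b)) (guard-0 (∣ a ∣ᵥ ℕ.≟ w))) ⟩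
      atLevel w a 0 * atLevel N b (q b)                ≈⟨ *-cong≈ (guard-cong≈ (∣ a ∣ᵥ ℕ.≟ w) (≈-sym q[a]≈0)) ≈-refl ⟩
      atLevel w a (q a) * atLevel N b (q b)           ∎
      where
      open ≈-Reasoning
      guard-0 : ∀ {P : Set} (dP : Dec P) → guard dP 0 ≡ 0
      guard-0 (yes _) = refl
      guard-0 (no _)  = refl
      q[a]≈0 : q a ≈ 0
      q[a]≈0 = ∣⇒≈0 (subst (λ n → p ∣ q n) (⊕-zeros a) (p∣q-reaching a zeros a<p reach))
    ... | no ¬reach = begin
      atLevel (w + N * p) (a ⊕[ p ] b) (q (a ⊕[ p ] b)) ≈⟨ guard-cong≈ (∣ a ⊕[ p ] b ∣ᵥ ℕ.≟ w + N * p) (q-multiplicative a b ¬reach) ⟩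
      atLevel (w + N * p) (a ⊕[ p ] b) (q a * q b)     ≡⟨ guard-* (∣ a ⊕[ p ] b ∣ᵥ ℕ.≟ w + N * p) (∣ a ∣ᵥ ℕ.≟ w) (∣ b ∣ᵥ ℕ.≟ N)
                                                              (level-⊕ a b w N |a|<p w<p) from (q a) (q b) ⟩
      atLevel w a (q a) * atLevel N b (q b)            ∎
      where
      open ≈-Reasoning
      -- a level |a| ≥ p would make some eᵢ·a reach p
      |a|<p : ∣ a ∣ᵥ < p
      |a|<p = ℕ.≰⇒> (λ p≤|a| → ¬reach (inj₁ (admissible⇒large-value d e admissible p a (s≤s z≤n) p≤|a|)))
      from : ∣ a ∣ᵥ ≡ w → ∣ b ∣ᵥ ≡ N → ∣ a ⊕[ p ] b ∣ᵥ ≡ w + N * p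
      from |a|≡w |b|≡N = trans (∣⊕∣ p a b) (cong₂ (λ x y → x + y * p) |a|≡w |b|≡N)

    lucas : ∀ w N → w < p → S (w + N * p) ≈ S w * S N
    lucas w N w<p = begin
      S (w + N * p)
        ≡⟨ compositions-boxSum d (w + N * p) (p′ + N * p) q (ℕ.+-monoˡ-≤ (N * p) (ℕ.≤-pred w<p)) ⟩
      boxSum d (suc N * p) (λ n → atLevel (w + N * p) n (q n))
        ≡⟨ boxSum-blocks d N p (λ n → atLevel (w + N * p) n (q n)) ⟩
      boxSum d p (λ a → boxSum d (suc N) (λ b → atLevel (w + N * p) (a ⊕[ p ] b) (q (a ⊕[ p ] b))))
        ≈⟨ boxSum-cong≈ p d p (λ a a<p → boxSum-cong≈ p d (suc N) (λ b _ → level-term w N a b w<p a<p)) ⟩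
      boxSum d p (λ a → boxSum d (suc N) (λ b → atLevel w a (q a) * atLevel N b (q b)))
        ≡⟨ boxSum-separate d p (suc N) (λ a → atLevel w a (q a)) (λ b → atLevel N b (q b)) ⟩
      boxSum d p (λ a → atLevel w a (q a)) * boxSum d (suc N) (λ b → atLevel N b (q b))
        ≡⟨ sym (cong₂ _*_ (compositions-boxSum d w p′ q (ℕ.≤-pred w<p)) (compositions-boxSum d N N q ℕ.≤-refl)) ⟩
      S w * S N
        ∎
      where open ≈-Reasoning

open import Data.Nat as ℕ using (ℕ; suc; _!)
import Data.Nat.Properties as ℕ
open import Data.Nat.Primality using (Prime; ¬prime[0])
open import Data.Integer as ℤ using (ℤ; +_)
import Data.Integer.Properties as ℤ
import Data.Integer.Divisibility.Signed as ℤ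
import Data.Integer.Divisibility as ℤ∣
open import Data.Rational as ℚ using (ℚ; _/_; 0ℚ; 1ℚ; toℚᵘ)
import Data.Rational.Properties as ℚ
import Data.Rational.Unnormalised as ℚᵘ
import Data.Rational.Unnormalised.Properties as ℚᵘ
open import Data.Vec as Vec using (Vec; []; _∷_)
open import Data.List as List using (List)
open import Data.Product using (Σ; _×_; _,_)
open import Data.Empty using (⊥-elim)
open import Relation.Binary.PropositionalEquality
open import Defs
open Congruence
open FiniteSums using (listSum)
open Factorials using (factorialProduct; factorialProduct-nonZero)
open LinearForms using (values)
open Rationals
open Integrality
open Lucas

-- Q_{e,f}(n) is by definition the rational product factorialsℚ e n ·
-- inverseFactorialsℚ f n; these are E(n) and 1/F(n)
factorialsℚ inverseFactorialsℚ : ∀ {d w} → Tuple d w → Vec ℕ d → ℚ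
factorialsℚ        g n = Vec.foldr (λ _ → ℚ) (λ a r → (+ (dotℕ a n !) / 1) ℚ.* r) 1ℚ g
inverseFactorialsℚ g n = Vec.foldr (λ _ → ℚ) (λ b r → invFact (dotℕ b n) ℚ.* r) 1ℚ g

∏-factorials : ∀ {d w} (g : Tuple d w) n →
  toℚᵘ (factorialsℚ g n) ℚᵘ.≃ (+ factorialProduct (values g n)) ℚᵘ./ 1
∏-factorials []      n = toℚᵘ-/ (+ 1) 0
∏-factorials (a ∷ g) n =
  ℚᵘ.≃-trans (ℚ.toℚᵘ-homo-* (+ (dotℕ a n !) / 1) _)
  (ℚᵘ.≃-trans (ℚᵘ.*-cong (toℚᵘ-/ (+ (dotℕ a n !)) 0) (∏-factorials g n))
              (*-fractions (dotℕ a n !) _ 1 1))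

∏-inverse-factorials : ∀ {d w} (g : Tuple d w) n →
  toℚᵘ (inverseFactorialsℚ g n) ℚᵘ.≃
    ((+ 1) ℚᵘ./ factorialProduct (values g n)) {{factorialProduct-nonZero (values g n)}}
∏-inverse-factorials []      n = toℚᵘ-/ (+ 1) 0
∏-inverse-factorials (b ∷ g) n =
  ℚᵘ.≃-trans (ℚ.toℚᵘ-homo-* (invFact (dotℕ b n)) _)
  (ℚᵘ.≃-trans (ℚᵘ.*-cong (toℚᵘ-/′ (+ 1) (dotℕ b n !) {{dotℕ b n ℕ.!≢0}}) (∏-inverse-factorials g n))
              (*-fractions 1 1 (dotℕ b n !) (factorialProduct (values g n))
                 {{dotℕ b n ℕ.!≢0}} {{factorialProduct-nonZero (values g n)}}))

module RationalValues {d u v} (e : Tuple d u) (f : Tuple d v) (balanced : tupleSum e ≡ tupleSum f)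
         (Δ≥1 : (x : Vec ℚ d) → InD e f x → + 1 ℤ.≤ Δ e f x) where
  open Quotient e f balanced Δ≥1

  Q≡q : ∀ n → Q e f n ≡ + q n / 1
  Q≡q n = ℚ.toℚᵘ-injective (ℚᵘ.≃-trans (ℚ.toℚᵘ-homo-* (factorialsℚ e n) (inverseFactorialsℚ f n))
    (ℚᵘ.≃-trans (ℚᵘ.*-cong (∏-factorials e n) (∏-inverse-factorials f n))
    (ℚᵘ.≃-trans (exact-quotient (E n) (q n) (F n)
                   {{factorialProduct-nonZero (values f n)}} (E≡q*F n))
                (ℚᵘ.≃-sym (toℚᵘ-/ (+ q n) 0)))))

  𝔖≡S : ∀ m → 𝔖 e f m ≡ + S m / 1
  𝔖≡S m = sum-of-integers (compositions d m)
    where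
    sum-of-integers : ∀ (ns : List (Vec ℕ d)) →
      List.foldr ℚ._+_ 0ℚ (List.map (Q e f) ns) ≡ + listSum ns q / 1
    sum-of-integers List.[]       = refl
    sum-of-integers (n List.∷ ns) =
      trans (cong₂ ℚ._+_ (Q≡q n) (sum-of-integers ns)) (+-integers (q n) (listSum ns _))

≈⇒LucasDivisibility : ∀ p {x y z} → Mod._≈_ p x (y ℕ.* z) → (+ p) ℤ∣.∣ (+ x ℤ.- + y ℤ.* + z)
≈⇒LucasDivisibility p {x} {y} {z} (Mod.mk≈ p∣) =
  ℤ.∣⇒∣ᵤ (subst (λ t → (+ p) ℤ.∣ (+ x ℤ.- t)) (ℤ.pos-* y z) p∣)

-- Proposition 2: 𝔖_{e,f} is integer-valued and has the p-Lucas property for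
-- every prime p (the argument does not use that e and f are disjoint)
proposition2 : (d u v : ℕ) (e : Tuple d u) (f : Tuple d v) →
    Disjoint e f →
    tupleSum e ≡ tupleSum f →
    ((x : Vec ℚ d) → InD e f x → + 1 ℤ.≤ Δ e f x) →
    OneAdmissible e →
    Σ (ℕ → ℤ) λ A →
    ((m : ℕ) → 𝔖 e f m ≡ (A m / 1)) ×
    ((p : ℕ) → Prime p → LucasProperty p A)
proposition2 d u v e f _ balanced Δ≥1 admissible = A , 𝔖≡S , lucas-property
  where
  open Quotient e f balanced Δ≥1 using (S)
  open RationalValues e f balanced Δ≥1 using (𝔖≡S)
  A : ℕ → ℤ
  A m = + S m
  lucas-property : (p : ℕ) → Prime p → LucasProperty p A
  lucas-property ℕ.zero  pr = ⊥-elim (¬prime[0] pr)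
  lucas-property (suc p′) pr w N w<p =
    ≈⇒LucasDivisibility (suc p′) {y = S w} {S N} (LucasCongruence.lucas e f balanced Δ≥1 admissible p′ pr w N w<p)
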